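{- Let $G$ be a finite semiabelian group. Then $\mathrm{wl}(G)=d(G)$ if and only if there exist a prime $p$, finite cyclic groups $C_1,\dots,C_r$ with $p$ dividing $|C_i|$ for all $i=1,\dots,r$, and an epimorphism $\pi:C_1\wr(C_2\wr(\cdots\wr C_r)\cdots)\to G$ with $d(C_1\wr(C_2\wr(\cdots\wr C_r)\cdots))=d(G)$.
   Context: For a finite group $G$, $d(G)$ is the smallest number $d$ such that there is a subset $S\subseteq G$ with $d$ elements whose normal closure in $G$ is $G$. A finite group is semiabelian if it belongs to the smallest family $\mathcal{SA}$ of finite groups such that: (i) every finite abelian group is in $\mathcal{SA}$; (ii) if $G\in\mathcal{SA}$ and $A$ is finite abelian then every semidirect product $A\rtimes G$ is in $\mathcal{SA}$; (iii) every homomorphic image of a group in $\mathcal{SA}$ is in $\mathcal{SA}$. For groups $H,G$, the standard wreath product $H\wr G$ is the set of pairs $(f,g)$, $f:G\to H$ a function, $g\in G$, with multiplication $(f_1,g_1)(f_2,g_2)=(f_1f_2^{g_1^{ -1}},g_1g_2)$, where $f^{g^{ -1}}(x)=f(xg)$. The wreath length $\mathrm{wl}(G)$ of a finite semiabelian group $G$ is the smallest positive integer $r$ such that there exist finite cyclic groups $C_1,\dots,C_r$ and an epimorphism $C_1\wr(C_2\wr(\cdots\wr C_r)\cdots)\to G$. -}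

module Defs where

open import Level using (0ℓ; suc)
open import Data.Nat as ℕ using (ℕ; _<_; _≤_)
open import Data.Fin using (Fin)
open import Data.Integer as ℤ using (ℤ; +_; _+_; _*_; -_; _-_)
open import Data.Integer.Tactic.RingSolver using (solve-∀)
open import Data.Product using (Σ; ∃; _×_; _,_; proj₁; proj₂)
open import Data.List using (List; []; _∷_)
open import Relation.Binary.PropositionalEquality as P using (_≡_; refl)
open import Relation.Nullary using (¬_)
open import Algebra.Bundles using (Group; RawGroup)
open import Algebra.Structures using (IsGroup)
import Algebra.Morphism.Structures as MS
import Relation.Binary.Reasoning.Setoid as SetoidR

Grp : Set₁
Grp = Group 0ℓ 0ℓ

module _ (G : Grp) where
  open Group G

  IsFinite : Set
  IsFinite = Σ ℕ λ n → Σ (Fin n → Carrier) λ e →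
               (∀ i j → e i ≈ e j → i ≡ j) × (∀ x → ∃ λ i → e i ≈ x)

  IsCommutative : Set
  IsCommutative = ∀ x y → (x ∙ y) ≈ (y ∙ x)

IsHom : (H G : Grp) → (Group.Carrier H → Group.Carrier G) → Set
IsHom H G f = MS.GroupMorphisms.IsGroupHomomorphism (Group.rawGroup H) (Group.rawGroup G) f

Epi : (H G : Grp) → Set
Epi H G = Σ (Group.Carrier H → Group.Carrier G) λ f →
            IsHom H G f × (∀ y → ∃ λ x → Group._≈_ G (f x) y)

-- Internal semidirect product: G ≅ A ⋊ H for some action of H on A,
-- i.e. a split short exact sequence  1 → A → G → H → 1.

IsSemidirect : (A H G : Grp) → Set
IsSemidirect A H G =
  Σ (Group.Carrier A → Group.Carrier G) λ ι →
  Σ (Group.Carrier G → Group.Carrier H) λ π →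
  Σ (Group.Carrier H → Group.Carrier G) λ s →
    IsHom A G ι × IsHom G H π × IsHom H G s
    × (∀ a b → Group._≈_ G (ι a) (ι b) → Group._≈_ A a b)
    × (∀ h → Group._≈_ H (π (s h)) h)
    × (∀ g → Group._≈_ H (π g) (Group.ε H) → ∃ λ a → Group._≈_ G (ι a) g)
    × (∀ a → Group._≈_ H (π (ι a)) (Group.ε H))

data SemiAbelian : Grp → Set₁ where
  abelian : ∀ G → IsFinite G → IsCommutative G → SemiAbelian G
  semidir : ∀ A H G → IsFinite A → IsCommutative A → SemiAbelian H →
            IsSemidirect A H G → SemiAbelian G
  image   : ∀ H G → SemiAbelian H → Epi H G → SemiAbelian G

-- d(G): least number of elements of a subset whose normal closure is G

module _ (G : Grp) where
  open Group G

  data InNormalClosure {d : ℕ} (S : Fin d → Carrier) : Carrier → Set where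
    conj : ∀ i g → InNormalClosure S ((g ⁻¹ ∙ S i) ∙ g)
    one  : InNormalClosure S ε
    mul  : ∀ {x y} → InNormalClosure S x → InNormalClosure S y → InNormalClosure S (x ∙ y)
    inv  : ∀ {x} → InNormalClosure S x → InNormalClosure S (x ⁻¹)
    resp : ∀ {x y} → x ≈ y → InNormalClosure S x → InNormalClosure S y

  NormallyGeneratedBy : ℕ → Set
  NormallyGeneratedBy d = Σ (Fin d → Carrier) λ S →
    (∀ i j → S i ≈ S j → i ≡ j) × (∀ x → InNormalClosure S x)

  IsNormalRank : ℕ → Set
  IsNormalRank d = NormallyGeneratedBy d × (∀ d' → d' < d → ¬ NormallyGeneratedBy d')

-- Cyclic group ℤ/mℤ (carrier ℤ, equality = congruence mod m)

module Cyclic (m : ℕ) where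
  _≈_ : ℤ → ℤ → Set
  x ≈ y = Σ ℤ λ k → x ≡ y + k * + m

  private
    M = + m
    l-refl : ∀ y M → y ≡ y + ℤ.0ℤ * M
    l-refl = solve-∀
    l-sym : ∀ y k M → y ≡ (y + k * M) + (- k) * M
    l-sym = solve-∀
    l-trans : ∀ z l k M → (z + l * M) + k * M ≡ z + (l + k) * M
    l-trans = solve-∀
    l-add : ∀ y k v l M → (y + k * M) + (v + l * M) ≡ (y + v) + (k + l) * M
    l-add = solve-∀
    l-neg : ∀ y k M → - (y + k * M) ≡ - y + (- k) * M
    l-neg = solve-∀
    l-assoc : ∀ x y z → (x + y) + z ≡ (x + (y + z)) + ℤ.0ℤ * M
    l-assoc x y z = lem x y z M
      where lem : ∀ x y z M → (x + y) + z ≡ (x + (y + z)) + ℤ.0ℤ * M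
            lem = solve-∀
    l-idl : ∀ x → ℤ.0ℤ + x ≡ x + ℤ.0ℤ * M
    l-idl x = lem x M
      where lem : ∀ x M → ℤ.0ℤ + x ≡ x + ℤ.0ℤ * M
            lem = solve-∀
    l-idr : ∀ x → x + ℤ.0ℤ ≡ x + ℤ.0ℤ * M
    l-idr x = lem x M
      where lem : ∀ x M → x + ℤ.0ℤ ≡ x + ℤ.0ℤ * M
            lem = solve-∀
    l-invl : ∀ x → (- x) + x ≡ ℤ.0ℤ + ℤ.0ℤ * M
    l-invl x = lem x M
      where lem : ∀ x M → (- x) + x ≡ ℤ.0ℤ + ℤ.0ℤ * M
            lem = solve-∀
    l-invr : ∀ x → x + (- x) ≡ ℤ.0ℤ + ℤ.0ℤ * M
    l-invr x = lem x M
      where lem : ∀ x M → x + (- x) ≡ ℤ.0ℤ + ℤ.0ℤ * M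
            lem = solve-∀

  group : Grp
  group = record
    { Carrier = ℤ ; _≈_ = _≈_ ; _∙_ = _+_ ; ε = ℤ.0ℤ ; _⁻¹ = -_
    ; isGroup = record
      { isMonoid = record
        { isSemigroup = record
          { isMagma = record
            { isEquivalence = record
              { refl = λ {y} → ℤ.0ℤ , l-refl y M
              ; sym = λ { {x} {y} (k , refl) → - k , l-sym y k M }
              ; trans = λ { {x} {y} {z} (k , refl) (l , refl) → l + k , l-trans z l k M }
              }
            ; ∙-cong = λ { {x} {y} {u} {v} (k , refl) (l , refl) → k + l , l-add y k v l M }
            }
          ; assoc = λ x y z → ℤ.0ℤ , l-assoc x y z
          }
        ; identity = (λ x → ℤ.0ℤ , l-idl x) , (λ x → ℤ.0ℤ , l-idr x)
        }
      ; inverse = (λ x → ℤ.0ℤ , l-invl x) , (λ x → ℤ.0ℤ , l-invr x)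
      ; ⁻¹-cong = λ { {x} {y} (k , refl) → - k , l-neg y k M }
      }
    }

-- Standard wreath product H ≀ G: pairs (f , g) with f : G → H (respecting
-- the equality of G) and g ∈ G, with
--   (f₁ , g₁)(f₂ , g₂) = (f₁ f₂^{g₁⁻¹} , g₁ g₂),  f^{g⁻¹}(x) = f(x g).

module Wreath (H G : Grp) where
  private
    module H = Group H
    module G = Group G

  record Fun : Set where
    constructor mkFun
    field
      app  : G.Carrier → H.Carrier
      cong : ∀ {x y} → x G.≈ y → app x H.≈ app y
  open Fun

  Carrier : Set
  Carrier = Fun × G.Carrier

  _≈_ : Carrier → Carrier → Set
  (f , g) ≈ (f' , g') = (∀ x → app f x H.≈ app f' x) × (g G.≈ g')

  _∙_ : Carrier → Carrier → Carrier
  (f₁ , g₁) ∙ (f₂ , g₂) =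
    mkFun (λ x → app f₁ x H.∙ app f₂ (x G.∙ g₁))
          (λ x≈y → H.∙-cong (cong f₁ x≈y) (cong f₂ (G.∙-congʳ x≈y)))
    , g₁ G.∙ g₂

  ε : Carrier
  ε = mkFun (λ _ → H.ε) (λ _ → H.refl) , G.ε

  _⁻¹ : Carrier → Carrier
  (f , g) ⁻¹ = mkFun (λ y → app f (y G.∙ g G.⁻¹) H.⁻¹)
                     (λ x≈y → H.⁻¹-cong (cong f (G.∙-congʳ x≈y)))
             , g G.⁻¹

  private
    module HR = SetoidR H.setoid
    open import Algebra.Properties.Group G using (∙-cancelʳ)

    assoc : ∀ a b c → ((a ∙ b) ∙ c) ≈ (a ∙ (b ∙ c))
    assoc (f₁ , g₁) (f₂ , g₂) (f₃ , g₃) =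
      (λ x → HR.begin
        (app f₁ x H.∙ app f₂ (x G.∙ g₁)) H.∙ app f₃ (x G.∙ (g₁ G.∙ g₂))
          HR.≈⟨ H.∙-congˡ (cong f₃ (G.sym (G.assoc x g₁ g₂))) ⟩
        (app f₁ x H.∙ app f₂ (x G.∙ g₁)) H.∙ app f₃ ((x G.∙ g₁) G.∙ g₂)
          HR.≈⟨ H.assoc _ _ _ ⟩
        app f₁ x H.∙ (app f₂ (x G.∙ g₁) H.∙ app f₃ ((x G.∙ g₁) G.∙ g₂)) HR.∎)
      , G.assoc g₁ g₂ g₃

    idl : ∀ a → (ε ∙ a) ≈ a
    idl (f , g) = (λ x → H.trans (H.identityˡ _) (cong f (G.identityʳ x))) , G.identityˡ g

    idr : ∀ a → (a ∙ ε) ≈ a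
    idr (f , g) = (λ x → H.identityʳ _) , G.identityʳ g

    invl : ∀ a → ((a ⁻¹) ∙ a) ≈ ε
    invl (f , g) =
      (λ x → H.inverseˡ (app f (x G.∙ g G.⁻¹))) , G.inverseˡ g

    invr : ∀ a → (a ∙ (a ⁻¹)) ≈ ε
    invr (f , g) =
      (λ x → H.trans (H.∙-congˡ (H.⁻¹-cong (cong f
                (G.trans (G.assoc x g (g G.⁻¹)) (G.trans (G.∙-congˡ (G.inverseʳ g)) (G.identityʳ x))))))
                (H.inverseʳ (app f x)))
      , G.inverseʳ g

  group : Grp
  group = record
    { Carrier = Carrier ; _≈_ = _≈_ ; _∙_ = _∙_ ; ε = ε ; _⁻¹ = _⁻¹
    ; isGroup = record
      { isMonoid = record
        { isSemigroup = record
          { isMagma = record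
            { isEquivalence = record
              { refl = (λ x → H.refl) , G.refl
              ; sym = λ (p , q) → (λ x → H.sym (p x)) , G.sym q
              ; trans = λ (p , q) (p' , q') → (λ x → H.trans (p x) (p' x)) , G.trans q q'
              }
            ; ∙-cong = λ { {f₁ , g₁} {f₁' , g₁'} {f₂ , g₂} {f₂' , g₂'} (p , q) (p' , q') →
                (λ x → H.∙-cong (p x) (H.trans (cong f₂ (G.∙-congˡ q)) (p' (x G.∙ g₁'))))
                , G.∙-cong q q' }
            }
          ; assoc = assoc
          }
        ; identity = idl , idr
        }
      ; inverse = invl , invr
      ; ⁻¹-cong = λ { {f , g} {f' , g'} (p , q) →
          (λ y → H.⁻¹-cong (H.trans (cong f (G.∙-congˡ (G.⁻¹-cong q))) (p (y G.∙ g' G.⁻¹))))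
          , G.⁻¹-cong q }
      }
    }

_≀_ : Grp → Grp → Grp
H ≀ G = Wreath.group H G

-- Iterated wreath product C₁ ≀ (C₂ ≀ (⋯ ≀ C_r)) of cyclic groups, where
-- C₁ = ℤ/m₁ and ms = [m₂ , … , m_r]   (so r = 1 + length ms)

IterWreath : ℕ → List ℕ → Grp
IterWreath m []        = Cyclic.group m
IterWreath m (m' ∷ ms) = Cyclic.group m ≀ IterWreath m' ms

open import Data.List using (length)
open import Data.List.Relation.Unary.All using (All)

module _ (G : Grp) where
  WreathCover : ℕ → Set
  WreathCover r = Σ ℕ λ m → Σ (List ℕ) λ ms →
    (ℕ.suc (length ms) ≡ r) × (1 ≤ m) × All (1 ≤_) ms × Epi (IterWreath m ms) G

  IsWreathLength : ℕ → Set
  IsWreathLength r = (1 ≤ r) × WreathCover r × (∀ r' → 1 ≤ r' → r' < r → ¬ WreathCover r')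

module Submission where

-- The standard generators x₁,…,x_r of W (x₁ the indicator of 1 in the base of
-- the outer layer, the others in its top group) normally generate W and
-- satisfy xᵢ^{mᵢ} = 1.  If p divides every mᵢ, adding up the base coordinates
-- of each layer mod p is a homomorphism W → (ℤ/p)^r, constant on conjugacy
-- classes, sending xᵢ to the i-th unit vector; by Gaussian elimination over
-- 𝔽_p every normally generating family then has ≥ r elements, so d(W) = r.
-- (⇐) Hence d(G) = r bounds wl(G) from above, and wl(G) ≥ d(G) because an
-- r'-fold cover yields r' normal generators of G.
-- (⇒) For a cover with r = d(G) factors let yᵢ be the images of the xᵢ.  If
-- gcd(mᵢ) = 1 then, modulo the normal closure of the r - 1 elements yᵢ₊₁y₁,
-- each yᵢ is y₁^{±1} and y₁ is trivial, so d(G) ≤ r - 1: a contradiction.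

open import Defs
open import Data.Nat as ℕ using (ℕ; zero; suc; _≤_; _<_)
import Data.Nat.Properties as ℕP
open import Data.Nat.DivMod using (m<n⇒m%n≡m)
open import Data.Nat.Divisibility using (_∣_; divides; ∣-trans; ∣⇒≤; 0∣⇒≡0)
open import Data.Nat.GCD using (gcd; gcd[m,n]∣m; gcd[m,n]∣n; gcd-GCD; module Bézout)
open import Data.Nat.Coprimality using (coprime-Bézout; prime⇒coprime)
open import Data.Nat.Primality using (Prime; ¬prime[0]; ¬prime[1])
open import Data.Nat.Primality.Factorisation using (factorise)
open import Data.Nat.ListAction using (product)
open import Data.Integer as ℤ using (ℤ; +_; -[1+_]; _+_; _*_; -_; _-_)
import Data.Integer.Properties as ℤP
open import Data.Integer.DivMod using (a≡a%ℕn+[a/ℕn]*n; n%ℕd<d)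
open import Data.Integer.Tactic.RingSolver using (solve-∀)
open import Data.Fin as F using (Fin; toℕ; fromℕ<)
import Data.Fin.Properties as FP
open import Data.Fin.Permutation using (permutation)
open import Data.List using (List; []; _∷_; length)
open import Data.List.Relation.Unary.All using (All; []; _∷_)
open import Data.Product using (Σ; ∃; _×_; _,_; proj₁; proj₂)
open import Data.Empty using (⊥-elim)
open import Relation.Binary.PropositionalEquality as P using (_≡_; refl; cong)
open import Relation.Nullary using (¬_; Dec; yes; no)
open import Relation.Nullary.Decidable using (¬?)
open import Function.Bundles using (_⇔_; mk⇔)
open import Algebra.Bundles using (Group)
import Algebra.Morphism.Structures as MS
import Algebra.Properties.Group as GroupProperties
import Algebra.Properties.Monoid.Mult as MonoidMult
import Algebra.Properties.Semiring.Sum as SemiringSum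
import Relation.Binary.Reasoning.Setoid as SetoidReasoning
open import Relation.Binary.Bundles using (Setoid)
open import Level using (0ℓ)

module ℤSum = SemiringSum ℤP.+-*-semiring

-- A listing e of the elements of G together with an index function that
-- inverts it up to ≈; every finite group admits one, and the wreath
-- construction below enumerates W from enumerations of its factors.
record Enum (G : Grp) : Set where
  open Group G using (Carrier; _≈_; sym; trans)
  field
    N        : ℕ
    e        : Fin N → Carrier
    idx      : Carrier → Fin N
    idx-ok   : ∀ x → e (idx x) ≈ x
    idx-cong : ∀ {x y} → x ≈ y → idx x ≡ idx y
    idx-e    : ∀ i → idx (e i) ≡ i

  idx-injective : ∀ {x y} → idx x ≡ idx y → x ≈ y
  idx-injective {x} {y} eq = trans (sym (idx-ok x)) (P.subst (λ i → e i ≈ y) (P.sym eq) (idx-ok y))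

  dec : ∀ x y → Dec (x ≈ y)
  dec x y with idx x F.≟ idx y
  ... | yes eq = yes (idx-injective eq)
  ... | no neq = no (λ x≈y → neq (idx-cong x≈y))

enumerate : ∀ {G} → IsFinite G → Enum G
enumerate {G} (N , e , inj , surj) = record
  { N = N ; e = e ; idx = idx ; idx-ok = λ x → proj₂ (surj x)
  ; idx-cong = λ {x} {y} x≈y → inj _ _ (trans (proj₂ (surj x)) (trans x≈y (sym (proj₂ (surj y)))))
  ; idx-e = λ i → inj _ _ (proj₂ (surj (e i)))
  }
  where
    open Group G using (sym; trans)
    idx = λ x → proj₁ (surj x)

module NormalClosure (G : Grp) where
  open Group G hiding (refl)
  open GroupProperties G
  open SetoidReasoning setoid

  NC : ∀ {d} → (Fin d → Carrier) → Carrier → Set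
  NC = InNormalClosure G

  conj-closed : ∀ {d} {S : Fin d → Carrier} {x} g → NC S x → NC S ((g ⁻¹ ∙ x) ∙ g)
  conj-closed {S = S} g (conj i h) = resp (conj-∙ (S i) h g) (conj i (h ∙ g))
    where
      conj-∙ : ∀ a h g → ((h ∙ g) ⁻¹ ∙ a) ∙ (h ∙ g) ≈ (g ⁻¹ ∙ ((h ⁻¹ ∙ a) ∙ h)) ∙ g
      conj-∙ a h g = begin
        ((h ∙ g) ⁻¹ ∙ a) ∙ (h ∙ g)      ≈⟨ ∙-congʳ (∙-congʳ (⁻¹-anti-homo-∙ h g)) ⟩
        ((g ⁻¹ ∙ h ⁻¹) ∙ a) ∙ (h ∙ g)   ≈⟨ sym (assoc _ _ _) ⟩
        (((g ⁻¹ ∙ h ⁻¹) ∙ a) ∙ h) ∙ g   ≈⟨ ∙-congʳ (∙-congʳ (assoc _ _ _)) ⟩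
        ((g ⁻¹ ∙ (h ⁻¹ ∙ a)) ∙ h) ∙ g   ≈⟨ ∙-congʳ (assoc _ _ _) ⟩
        (g ⁻¹ ∙ ((h ⁻¹ ∙ a) ∙ h)) ∙ g   ∎
  conj-closed g one = resp (sym (trans (∙-congʳ (identityʳ _)) (inverseˡ g))) one
  conj-closed g (mul {x} {y} p q) = resp conj-homo (mul (conj-closed g p) (conj-closed g q))
    where
      conj-homo : ((g ⁻¹ ∙ x) ∙ g) ∙ ((g ⁻¹ ∙ y) ∙ g) ≈ (g ⁻¹ ∙ (x ∙ y)) ∙ g
      conj-homo = begin
        ((g ⁻¹ ∙ x) ∙ g) ∙ ((g ⁻¹ ∙ y) ∙ g) ≈⟨ sym (assoc _ _ _) ⟩
        (((g ⁻¹ ∙ x) ∙ g) ∙ (g ⁻¹ ∙ y)) ∙ g ≈⟨ ∙-congʳ (assoc _ _ _) ⟩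
        ((g ⁻¹ ∙ x) ∙ (g ∙ (g ⁻¹ ∙ y))) ∙ g ≈⟨ ∙-congʳ (∙-congˡ (sym (assoc _ _ _))) ⟩
        ((g ⁻¹ ∙ x) ∙ ((g ∙ g ⁻¹) ∙ y)) ∙ g ≈⟨ ∙-congʳ (∙-congˡ (∙-congʳ (inverseʳ g))) ⟩
        ((g ⁻¹ ∙ x) ∙ (ε ∙ y)) ∙ g         ≈⟨ ∙-congʳ (∙-congˡ (identityˡ y)) ⟩
        ((g ⁻¹ ∙ x) ∙ y) ∙ g               ≈⟨ ∙-congʳ (assoc _ _ _) ⟩
        (g ⁻¹ ∙ (x ∙ y)) ∙ g               ∎
  conj-closed g (inv {x} p) = resp conj-inv (inv (conj-closed g p))
    where
      conj-inv : ((g ⁻¹ ∙ x) ∙ g) ⁻¹ ≈ (g ⁻¹ ∙ x ⁻¹) ∙ g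
      conj-inv = begin
        ((g ⁻¹ ∙ x) ∙ g) ⁻¹       ≈⟨ ⁻¹-anti-homo-∙ _ _ ⟩
        g ⁻¹ ∙ (g ⁻¹ ∙ x) ⁻¹      ≈⟨ ∙-congˡ (⁻¹-anti-homo-∙ _ _) ⟩
        g ⁻¹ ∙ (x ⁻¹ ∙ g ⁻¹ ⁻¹)   ≈⟨ ∙-congˡ (∙-congˡ (⁻¹-involutive g)) ⟩
        g ⁻¹ ∙ (x ⁻¹ ∙ g)         ≈⟨ sym (assoc _ _ _) ⟩
        (g ⁻¹ ∙ x ⁻¹) ∙ g         ∎
  conj-closed g (resp x≈y p) = resp (∙-congʳ (∙-congˡ x≈y)) (conj-closed g p)

  Covers : ∀ {k k'} → (Fin k → Carrier) → (Fin k' → Carrier) → Set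
  Covers S S' = ∀ i → ∃ λ j → S i ≈ S' j

  covers-mono : ∀ {k k'} {S : Fin k → Carrier} {S' : Fin k' → Carrier} →
                Covers S S' → ∀ {x} → NC S x → NC S' x
  covers-mono cov (conj i g) = resp (∙-congʳ (∙-congˡ (sym (proj₂ (cov i))))) (conj (proj₁ (cov i)) g)
  covers-mono cov one = one
  covers-mono cov (mul a b) = mul (covers-mono cov a) (covers-mono cov b)
  covers-mono cov (inv a) = inv (covers-mono cov a)
  covers-mono cov (resp x≈y a) = resp x≈y (covers-mono cov a)

  deduplicate : Enum G → ∀ {k} (S : Fin k → Carrier) →
                Σ ℕ λ k' → k' ≤ k × Σ (Fin k' → Carrier) λ S' →
                  (∀ i j → S' i ≈ S' j → i ≡ j) × Covers S S'
  deduplicate E {zero} S = 0 , ℕ.z≤n , (λ ()) , (λ ()) , (λ ())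
  deduplicate E {suc k} S with deduplicate E (λ i → S (F.suc i))
  ... | k' , k'≤k , S' , inj , cov with FP.any? (λ j → Enum.dec E (S F.zero) (S' j))
  ...   | yes (j , S₀≈) = k' , ℕP.m≤n⇒m≤1+n k'≤k , S' , inj , λ { F.zero → j , S₀≈ ; (F.suc i) → cov i }
  ...   | no S₀∉ = suc k' , ℕ.s≤s k'≤k , S'' , inj'' , cov''
    where
      S'' : Fin (suc k') → Carrier
      S'' F.zero = S F.zero
      S'' (F.suc j) = S' j
      inj'' : ∀ i j → S'' i ≈ S'' j → i ≡ j
      inj'' F.zero F.zero _ = refl
      inj'' F.zero (F.suc j) eq = ⊥-elim (S₀∉ (j , eq))
      inj'' (F.suc i) F.zero eq = ⊥-elim (S₀∉ (i , sym eq))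
      inj'' (F.suc i) (F.suc j) eq = cong F.suc (inj i j eq)
      cov'' : Covers S S''
      cov'' F.zero = F.zero , Group.refl G
      cov'' (F.suc i) = F.suc (proj₁ (cov i)) , proj₂ (cov i)

  normalRank-≤ : IsFinite G → ∀ {d k} → IsNormalRank G d → (S : Fin k → Carrier) →
                 (∀ x → NC S x) → d ≤ k
  normalRank-≤ fin {d} {k} (_ , minimal) S gen with deduplicate (enumerate fin) S
  ... | k' , k'≤k , S' , inj , cov = ℕP.≮⇒≥ λ k<d →
    minimal k' (ℕP.≤-<-trans k'≤k k<d) (S' , inj , λ x → covers-mono cov (gen x))

module Powers (G : Grp) where
  open Group G renaming (refl to ≈-refl)
  open MonoidMult monoid public using () renaming (_×_ to pow)
  open MonoidMult monoid using (×-congʳ; ×-homo-+; ×-assocˡ)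
  open GroupProperties G using (ε⁻¹≈ε; ⁻¹-anti-homo-∙)
  open SetoidReasoning setoid

  pow-cong : ∀ n {x y} → x ≈ y → pow n x ≈ pow n y
  pow-cong n = ×-congʳ n

  pow-+ : ∀ a b x → pow (a ℕ.+ b) x ≈ pow a x ∙ pow b x
  pow-+ a b x = ×-homo-+ x a b

  pow-* : ∀ a b x → pow (a ℕ.* b) x ≈ pow a (pow b x)
  pow-* a b x = sym (×-assocˡ x a b)

  pow-ε : ∀ n → pow n ε ≈ ε
  pow-ε zero = ≈-refl
  pow-ε (suc n) = trans (identityˡ _) (pow-ε n)

  pow-comm : ∀ n x → pow n x ∙ x ≈ x ∙ pow n x
  pow-comm zero x = trans (identityˡ x) (sym (identityʳ x))
  pow-comm (suc n) x = trans (assoc _ _ _) (∙-congˡ (pow-comm n x))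

  pow-⁻¹ : ∀ n x → pow n (x ⁻¹) ≈ (pow n x) ⁻¹
  pow-⁻¹ zero x = sym ε⁻¹≈ε
  pow-⁻¹ (suc n) x = begin
    x ⁻¹ ∙ pow n (x ⁻¹)    ≈⟨ ∙-congˡ (pow-⁻¹ n x) ⟩
    x ⁻¹ ∙ (pow n x) ⁻¹    ≈⟨ sym (⁻¹-anti-homo-∙ (pow n x) x) ⟩
    (pow n x ∙ x) ⁻¹       ≈⟨ ⁻¹-cong (pow-comm n x) ⟩
    (x ∙ pow n x) ⁻¹       ∎

module Image {H G : Grp} (f : Group.Carrier H → Group.Carrier G) (hom : IsHom H G f) where
  private
    module H = Group H
    module G = Group G
  open MS.IsGroupHomomorphism hom

  image-closure : ∀ {d} {S : Fin d → H.Carrier} {x} →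
                  InNormalClosure H S x → InNormalClosure G (λ i → f (S i)) (f x)
  image-closure (conj i g) =
    resp (G.sym (G.trans (homo _ _) (G.∙-congʳ (G.trans (homo _ _) (G.∙-congʳ (⁻¹-homo g))))))
         (conj i (f g))
  image-closure one = resp (G.sym ε-homo) one
  image-closure (mul p q) = resp (G.sym (homo _ _)) (mul (image-closure p) (image-closure q))
  image-closure (inv p) = resp (G.sym (⁻¹-homo _)) (inv (image-closure p))
  image-closure (resp x≈y p) = resp (⟦⟧-cong x≈y) (image-closure p)

  pow-homo : ∀ n x → f (Powers.pow H n x) G.≈ Powers.pow G n (f x)
  pow-homo zero x = ε-homo
  pow-homo (suc n) x = G.trans (homo _ _) (G.∙-congˡ (pow-homo n x))

module _ {H G : Grp} (E : Epi H G) where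
  private
    f = proj₁ E

  epi-generates : ∀ {k} (S : Fin k → Group.Carrier H) → (∀ x → InNormalClosure H S x) →
                  ∀ y → InNormalClosure G (λ i → f (S i)) y
  epi-generates S gen y with proj₂ (proj₂ E) y
  ... | x , fx≈y = resp fx≈y (Image.image-closure f (proj₁ (proj₂ E)) (gen x))

  normalRank-epi : IsFinite G → ∀ {d k} → IsNormalRank G d → (S : Fin k → Group.Carrier H) →
                   (∀ x → InNormalClosure H S x) → d ≤ k
  normalRank-epi fin rank S gen =
    NormalClosure.normalRank-≤ G fin rank (λ i → f (S i)) (epi-generates S gen)

module Quotient (G : Grp) {n} (z : Fin n → Group.Carrier G) where
  open Group G hiding (refl)
  open GroupProperties G using (x≈y⇒x∙y⁻¹≈ε; ⁻¹-anti-homo-∙; ⁻¹-involutive; ε⁻¹≈ε)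
  open NormalClosure G using (NC; conj-closed)
  open SetoidReasoning setoid

  infix 4 _~_
  _~_ : Carrier → Carrier → Set
  x ~ y = NC z (x ∙ y ⁻¹)

  ≈⇒~ : ∀ {x y} → x ≈ y → x ~ y
  ≈⇒~ x≈y = resp (sym (x≈y⇒x∙y⁻¹≈ε x≈y)) one

  ~-sym : ∀ {x y} → x ~ y → y ~ x
  ~-sym {x} {y} x~y = resp (trans (⁻¹-anti-homo-∙ x (y ⁻¹)) (∙-congʳ (⁻¹-involutive y))) (inv x~y)

  ~-trans : ∀ {x y w} → x ~ y → y ~ w → x ~ w
  ~-trans {x} {y} {w} x~y y~w = resp cancel (mul x~y y~w)
    where
      cancel : (x ∙ y ⁻¹) ∙ (y ∙ w ⁻¹) ≈ x ∙ w ⁻¹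
      cancel = begin
        (x ∙ y ⁻¹) ∙ (y ∙ w ⁻¹)  ≈⟨ assoc _ _ _ ⟩
        x ∙ (y ⁻¹ ∙ (y ∙ w ⁻¹))  ≈⟨ ∙-congˡ (sym (assoc _ _ _)) ⟩
        x ∙ ((y ⁻¹ ∙ y) ∙ w ⁻¹)  ≈⟨ ∙-congˡ (∙-congʳ (inverseˡ y)) ⟩
        x ∙ (ε ∙ w ⁻¹)           ≈⟨ ∙-congˡ (identityˡ _) ⟩
        x ∙ w ⁻¹                 ∎

  -- N is normal, so ~ is compatible with multiplication
  ~-∙ : ∀ {x y u v} → x ~ y → u ~ v → (x ∙ u) ~ (y ∙ v)
  ~-∙ {x} {y} {u} {v} x~y u~v = resp regroup (mul x~y (conj-closed (y ⁻¹) u~v))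
    where
      regroup : (x ∙ y ⁻¹) ∙ ((y ⁻¹ ⁻¹ ∙ (u ∙ v ⁻¹)) ∙ y ⁻¹) ≈ (x ∙ u) ∙ (y ∙ v) ⁻¹
      regroup = begin
        (x ∙ y ⁻¹) ∙ ((y ⁻¹ ⁻¹ ∙ (u ∙ v ⁻¹)) ∙ y ⁻¹) ≈⟨ ∙-congˡ (∙-congʳ (∙-congʳ (⁻¹-involutive y))) ⟩
        (x ∙ y ⁻¹) ∙ ((y ∙ (u ∙ v ⁻¹)) ∙ y ⁻¹)       ≈⟨ assoc _ _ _ ⟩
        x ∙ (y ⁻¹ ∙ ((y ∙ (u ∙ v ⁻¹)) ∙ y ⁻¹))       ≈⟨ ∙-congˡ (sym (assoc _ _ _)) ⟩
        x ∙ ((y ⁻¹ ∙ (y ∙ (u ∙ v ⁻¹))) ∙ y ⁻¹)       ≈⟨ ∙-congˡ (∙-congʳ (sym (assoc _ _ _))) ⟩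
        x ∙ (((y ⁻¹ ∙ y) ∙ (u ∙ v ⁻¹)) ∙ y ⁻¹)       ≈⟨ ∙-congˡ (∙-congʳ (∙-congʳ (inverseˡ y))) ⟩
        x ∙ ((ε ∙ (u ∙ v ⁻¹)) ∙ y ⁻¹)                ≈⟨ ∙-congˡ (∙-congʳ (identityˡ _)) ⟩
        x ∙ ((u ∙ v ⁻¹) ∙ y ⁻¹)                      ≈⟨ ∙-congˡ (assoc _ _ _) ⟩
        x ∙ (u ∙ (v ⁻¹ ∙ y ⁻¹))                      ≈⟨ sym (assoc _ _ _) ⟩
        (x ∙ u) ∙ (v ⁻¹ ∙ y ⁻¹)                      ≈⟨ ∙-congˡ (sym (⁻¹-anti-homo-∙ y v)) ⟩
        (x ∙ u) ∙ (y ∙ v) ⁻¹                         ∎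

  ~-⁻¹ : ∀ {x y} → x ~ y → (x ⁻¹) ~ (y ⁻¹)
  ~-⁻¹ {x} {y} x~y = resp regroup (inv (conj-closed x x~y))
    where
      regroup : ((x ⁻¹ ∙ (x ∙ y ⁻¹)) ∙ x) ⁻¹ ≈ x ⁻¹ ∙ y ⁻¹ ⁻¹
      regroup = begin
        ((x ⁻¹ ∙ (x ∙ y ⁻¹)) ∙ x) ⁻¹ ≈⟨ ⁻¹-cong (∙-congʳ (sym (assoc _ _ _))) ⟩
        (((x ⁻¹ ∙ x) ∙ y ⁻¹) ∙ x) ⁻¹ ≈⟨ ⁻¹-cong (∙-congʳ (∙-congʳ (inverseˡ x))) ⟩
        ((ε ∙ y ⁻¹) ∙ x) ⁻¹          ≈⟨ ⁻¹-cong (∙-congʳ (identityˡ _)) ⟩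
        (y ⁻¹ ∙ x) ⁻¹                ≈⟨ ⁻¹-anti-homo-∙ _ _ ⟩
        x ⁻¹ ∙ y ⁻¹ ⁻¹               ∎

  G/N : Grp
  G/N = record
    { Carrier = Carrier ; _≈_ = _~_ ; _∙_ = _∙_ ; ε = ε ; _⁻¹ = _⁻¹
    ; isGroup = record
      { isMonoid = record
        { isSemigroup = record
          { isMagma = record
            { isEquivalence = record { refl = ≈⇒~ (Group.refl G) ; sym = ~-sym ; trans = ~-trans }
            ; ∙-cong = ~-∙ }
          ; assoc = λ x y w → ≈⇒~ (assoc x y w) }
        ; identity = (λ x → ≈⇒~ (identityˡ x)) , (λ x → ≈⇒~ (identityʳ x)) }
      ; inverse = (λ x → ≈⇒~ (inverseˡ x)) , (λ x → ≈⇒~ (inverseʳ x))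
      ; ⁻¹-cong = ~-⁻¹ }
    }

  pow-quotient : ∀ k x → Powers.pow G/N k x ≡ Powers.pow G k x
  pow-quotient zero x = refl
  pow-quotient (suc k) x = cong (x ∙_) (pow-quotient k x)

  ~ε⇒∈N : ∀ {x} → x ~ ε → NC z x
  ~ε⇒∈N {x} x~ε = resp (trans (∙-congˡ ε⁻¹≈ε) (identityʳ x)) x~ε

  z~ε : ∀ i → z i ~ ε
  z~ε i = resp (begin
    (ε ⁻¹ ∙ z i) ∙ ε  ≈⟨ identityʳ _ ⟩
    ε ⁻¹ ∙ z i        ≈⟨ ∙-congʳ ε⁻¹≈ε ⟩
    ε ∙ z i           ≈⟨ identityˡ _ ⟩
    z i               ≈⟨ sym (identityʳ _) ⟩
    z i ∙ ε           ≈⟨ ∙-congˡ (sym ε⁻¹≈ε) ⟩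
    z i ∙ ε ⁻¹        ∎) (conj i ε)

gcdAll : ∀ {k} → (Fin k → ℕ) → ℕ
gcdAll {zero} o = 0
gcdAll {suc k} o = gcd (o F.zero) (gcdAll (λ i → o (F.suc i)))

gcdAll-∣ : ∀ {k} (o : Fin k → ℕ) i → gcdAll o ∣ o i
gcdAll-∣ {suc k} o F.zero = gcd[m,n]∣m (o F.zero) _
gcdAll-∣ {suc k} o (F.suc i) = ∣-trans (gcd[m,n]∣n (o F.zero) _) (gcdAll-∣ (λ j → o (F.suc j)) i)

-- Modulo N every yᵢ₊₁ is y₀⁻¹, so y₀^{oᵢ} ∈ N
-- for all i, hence y₀^{gcd(oᵢ)} ∈ N by Bézout.
module Collapse (G : Grp) {n} (y : Fin (suc n) → Group.Carrier G) (o : Fin (suc n) → ℕ)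
                (y-order : ∀ i → Group._≈_ G (Powers.pow G (o i) (y i)) (Group.ε G)) where
  open Group G hiding (refl)
  z : Fin n → Carrier
  z i = y (F.suc i) ∙ y F.zero
  open Quotient G z
  private
    module Q = Group G/N
    module QP = Powers G/N
    module QG = GroupProperties G/N
  y₀ = y F.zero

  Annihilates : ℕ → Set
  Annihilates d = QP.pow d y₀ ~ ε

  pow~pow : ∀ d x → QP.pow d x ~ Powers.pow G d x
  pow~pow d x = ≈⇒~ (P.subst (λ t → QP.pow d x ≈ t) (pow-quotient d x) (Group.refl G))

  yᵢ₊₁~y₀⁻¹ : ∀ i → y (F.suc i) ~ y₀ ⁻¹
  yᵢ₊₁~y₀⁻¹ i = QG.inverseˡ-unique (y (F.suc i)) y₀ (z~ε i)

  annihilates-order : ∀ i → Annihilates (o i)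
  annihilates-order F.zero = Q.trans (pow~pow (o F.zero) y₀) (≈⇒~ (y-order F.zero))
  annihilates-order (F.suc i) =
    Q.trans (Q.sym (QG.⁻¹-involutive _)) (Q.trans (~-⁻¹ inverse-annihilated) QG.ε⁻¹≈ε)
    where
      -- y₀^{-oᵢ₊₁} = yᵢ₊₁^{oᵢ₊₁} = 1 modulo N
      inverse-annihilated : (QP.pow (o (F.suc i)) y₀) ⁻¹ ~ ε
      inverse-annihilated =
        Q.trans (Q.sym (QP.pow-⁻¹ (o (F.suc i)) y₀))
          (Q.trans (QP.pow-cong (o (F.suc i)) (Q.sym (yᵢ₊₁~y₀⁻¹ i)))
            (Q.trans (pow~pow (o (F.suc i)) (y (F.suc i))) (≈⇒~ (y-order (F.suc i)))))

  annihilates-* : ∀ x a → Annihilates a → Annihilates (x ℕ.* a)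
  annihilates-* x a ann = Q.trans (QP.pow-* x a y₀) (Q.trans (QP.pow-cong x ann) (QP.pow-ε x))

  annihilates-∸ : ∀ g c d → g ℕ.+ c ≡ d → Annihilates c → Annihilates d → Annihilates g
  annihilates-∸ g c d eq ann-c ann-d = Q.trans (Q.sym (Q.identityʳ _))
    (Q.trans (Q.∙-congˡ (Q.sym ann-c)) (Q.trans (Q.sym (QP.pow-+ g c y₀))
      (P.subst Annihilates (P.sym eq) ann-d)))

  annihilates-gcd : ∀ a b → Annihilates a → Annihilates b → Annihilates (gcd a b)
  annihilates-gcd a b ann-a ann-b with Bézout.identity (gcd-GCD a b)
  ... | Bézout.+- x y' eq =
    annihilates-∸ (gcd a b) (y' ℕ.* b) (x ℕ.* a) eq (annihilates-* y' b ann-b) (annihilates-* x a ann-a)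
  ... | Bézout.-+ x y' eq =
    annihilates-∸ (gcd a b) (x ℕ.* a) (y' ℕ.* b) eq (annihilates-* x a ann-a) (annihilates-* y' b ann-b)

  annihilates-gcdAll : ∀ {k} (o' : Fin k → ℕ) → (∀ i → Annihilates (o' i)) → Annihilates (gcdAll o')
  annihilates-gcdAll {zero} o' ann = Q.refl
  annihilates-gcdAll {suc k} o' ann =
    annihilates-gcd (o' F.zero) _ (ann F.zero) (annihilates-gcdAll (λ i → o' (F.suc i)) (λ i → ann (F.suc i)))

  collapse : gcdAll o ≡ 1 → (∀ x → InNormalClosure G y x) → ∀ x → InNormalClosure G z x
  collapse gcd≡1 gen x = ~ε⇒∈N (trivial (gen x))
    where
      y₀~ε : y₀ ~ ε
      y₀~ε = Q.trans (Q.sym (Q.identityʳ y₀)) (P.subst Annihilates gcd≡1 (annihilates-gcdAll o annihilates-order))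
      y~ε : ∀ i → y i ~ ε
      y~ε F.zero = y₀~ε
      y~ε (F.suc i) = Q.trans (yᵢ₊₁~y₀⁻¹ i) (Q.trans (~-⁻¹ y₀~ε) QG.ε⁻¹≈ε)
      trivial : ∀ {x} → InNormalClosure G y x → x ~ ε
      trivial (conj i g) =
        Q.trans (~-∙ (~-∙ (Q.refl {g ⁻¹}) (y~ε i)) (Q.refl {g})) (≈⇒~ (trans (∙-congʳ (identityʳ _)) (inverseˡ g)))
      trivial one = Q.refl
      trivial (mul a b) = Q.trans (~-∙ (trivial a) (trivial b)) (Q.identityʳ ε)
      trivial (inv a) = Q.trans (~-⁻¹ (trivial a)) QG.ε⁻¹≈ε
      trivial (resp x≈x' a) = Q.trans (Q.sym (≈⇒~ x≈x')) (trivial a)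

  gcd≢1 : IsFinite G → IsNormalRank G (suc n) → (∀ x → InNormalClosure G y x) → ¬ gcdAll o ≡ 1
  gcd≢1 fin rank gen gcd≡1 =
    ℕP.<-irrefl refl (NormalClosure.normalRank-≤ G fin rank z (collapse gcd≡1 gen))

prime-factor : ∀ g → 2 ≤ g → Σ ℕ λ p → Prime p × p ∣ g
prime-factor (suc zero) (ℕ.s≤s ())
prime-factor g@(suc (suc _)) _ with factorise g
... | record { factors = [] ; isFactorisation = eq } = ⊥-elim (ℕP.1+n≢0 (ℕP.suc-injective eq))
... | record { factors = p ∷ ps ; isFactorisation = eq ; factorsPrime = p-prime ∷ _ } =
  p , p-prime , divides (product ps) (P.trans eq (ℕP.*-comm p (product ps)))

δ : ∀ {n} → Fin n → Fin n → ℤ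
δ F.zero F.zero = + 1
δ F.zero (F.suc _) = + 0
δ (F.suc _) F.zero = + 0
δ (F.suc j) (F.suc i) = δ j i

δ-diag : ∀ {n} (i : Fin n) → δ i i ≡ + 1
δ-diag F.zero = refl
δ-diag (F.suc i) = δ-diag i

δ-off : ∀ {n} (j i : Fin n) → ¬ j ≡ i → δ j i ≡ + 0
δ-off F.zero F.zero j≢i = ⊥-elim (j≢i refl)
δ-off F.zero (F.suc i) j≢i = refl
δ-off (F.suc j) F.zero j≢i = refl
δ-off (F.suc j) (F.suc i) j≢i = δ-off j i (λ eq → j≢i (cong F.suc eq))

δ-sym : ∀ {n} (i j : Fin n) → δ i j ≡ δ j i
δ-sym F.zero F.zero = refl
δ-sym F.zero (F.suc j) = refl
δ-sym (F.suc i) F.zero = refl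
δ-sym (F.suc i) (F.suc j) = δ-sym i j

δ-cong : ∀ {n n'} (j i : Fin n) (j' i' : Fin n') → (j ≡ i → j' ≡ i') → (j' ≡ i' → j ≡ i) →
         δ j i ≡ δ j' i'
δ-cong j i j' i' to from with j F.≟ i
... | yes refl = P.trans (δ-diag j) (P.sym (P.subst (λ t → δ j' t ≡ + 1) (to refl) (δ-diag j')))
... | no j≢i = P.trans (δ-off j i j≢i) (P.sym (δ-off j' i' (λ eq → j≢i (from eq))))

sum-zero : ∀ {n} (h : Fin n → ℤ) → (∀ i → h i ≡ + 0) → ℤSum.sum h ≡ + 0
sum-zero {n} h h≡0 = P.trans (ℤSum.sum-cong-≗ h≡0) (ℤSum.sum-replicate-zero n)

sum-δ : ∀ {n} (c : Fin n → ℤ) j → ℤSum.sum (λ i → c i * δ j i) ≡ c j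
sum-δ {suc n} c F.zero =
  P.trans (P.cong₂ _+_ (ℤP.*-identityʳ (c F.zero)) (sum-zero _ (λ i → ℤP.*-zeroʳ (c (F.suc i)))))
          (ℤP.+-identityʳ (c F.zero))
sum-δ {suc n} c (F.suc j) =
  P.trans (cong (_+ ℤSum.sum (λ i → c (F.suc i) * δ j i)) (ℤP.*-zeroʳ (c F.zero)))
          (P.trans (ℤP.+-identityˡ _) (sum-δ (λ i → c (F.suc i)) j))

sum-neg : ∀ {n} (a : Fin n → ℤ) → ℤSum.sum (λ i → - a i) ≡ - ℤSum.sum a
sum-neg {zero} a = refl
sum-neg {suc n} a = P.trans (cong (λ t → - a F.zero + t) (sum-neg (λ i → a (F.suc i))))
                            (P.sym (ℤP.neg-distrib-+ (a F.zero) (ℤSum.sum (λ i → a (F.suc i)))))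

flip-multiple : ∀ a b k M → a ≡ b + k * M → b ≡ a + (- k) * M
flip-multiple a b k M refl = cancel b k M
  where cancel : ∀ b k M → b ≡ (b + k * M) + (- k) * M
        cancel = solve-∀

residue-unique : ∀ m a b → a < m → b < m → (k : ℤ) → + a ≡ + b + k * + m → a ≡ b
residue-unique m a b a<m b<m (+ zero) eq = ℤP.+-injective (P.trans eq (ℤP.+-identityʳ (+ b)))
residue-unique m a b a<m b<m (+ suc n) eq = ⊥-elim (ℕP.<⇒≱ a<m m≤a)
  where
    a≡ : a ≡ b ℕ.+ suc n ℕ.* m
    a≡ = ℤP.+-injective (P.trans eq (P.trans (cong (λ t → + b + t) (P.sym (ℤP.pos-* (suc n) m)))
                                            (P.sym (ℤP.pos-+ b (suc n ℕ.* m)))))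
    m≤a : m ≤ a
    m≤a = P.subst (m ≤_) (P.sym a≡) (ℕP.≤-trans (ℕP.m≤m+n m (n ℕ.* m)) (ℕP.m≤n+m (suc n ℕ.* m) b))
residue-unique m a b a<m b<m -[1+ n ] eq =
  P.sym (residue-unique m b a b<m a<m (+ suc n) (flip-multiple (+ a) (+ b) -[1+ n ] (+ m) eq))

module Mod (M : ℕ) where
  private
    module C = Group (Cyclic.group M)

  -- congruence modulo M (the equality of ℤ/M), wrapped in a record so that
  -- both sides of a congruence can be inferred from its type
  infix 4 _~_
  record _~_ (a b : ℤ) : Set where
    constructor mod
    field witness : Cyclic._≈_ M a b
  open _~_ public

  ~-setoid : Setoid 0ℓ 0ℓ
  ~-setoid = record
    { Carrier = ℤ ; _≈_ = _~_
    ; isEquivalence = record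
      { refl = mod C.refl
      ; sym = λ {a} {b} a~b → mod (C.sym {a} {b} (witness a~b))
      ; trans = λ {a} {b} {c} a~b b~c → mod (C.trans {a} {b} {c} (witness a~b) (witness b~c)) } }

  open Setoid ~-setoid public using () renaming (refl to ~-refl; sym to ~-sym; trans to ~-trans)
  module ~-Reasoning = SetoidReasoning ~-setoid

  ≡⇒~ : ∀ {a b} → a ≡ b → a ~ b
  ≡⇒~ refl = ~-refl

  +-cong : ∀ {a b c d} → a ~ b → c ~ d → a + c ~ b + d
  +-cong {a} {b} {c} {d} (mod a~b) (mod c~d) = mod (C.∙-cong {a} {b} {c} {d} a~b c~d)

  +-congˡ : ∀ a {c d} → c ~ d → a + c ~ a + d
  +-congˡ a = +-cong (~-refl {a})

  +-congʳ : ∀ b {a c} → a ~ c → a + b ~ c + b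
  +-congʳ b a~c = +-cong a~c (~-refl {b})

  neg-cong : ∀ {a b} → a ~ b → - a ~ - b
  neg-cong {a} {b} (mod a~b) = mod (C.⁻¹-cong {a} {b} a~b)

  *-congˡ : ∀ c {a b} → a ~ b → c * a ~ c * b
  *-congˡ c {b = b} (mod (k , refl)) = mod (c * k , distrib c b k (+ M))
    where distrib : ∀ c b k M → c * (b + k * M) ≡ c * b + (c * k) * M
          distrib = solve-∀

  *-congʳ : ∀ c {a b} → a ~ b → a * c ~ b * c
  *-congʳ c {a} {b} a~b = P.subst₂ _~_ (ℤP.*-comm c a) (ℤP.*-comm c b) (*-congˡ c a~b)

  reduce : ∀ {P} → P ∣ M → ∀ {a b} → a ~ b → Cyclic._≈_ P a b
  reduce {P} (divides q refl) {b = b} (mod (k , refl)) =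
    k * + q , P.trans (cong (λ t → b + k * t) (ℤP.pos-* q P)) (regroup b k (+ q) (+ P))
    where regroup : ∀ b k q P → b + k * (q * P) ≡ b + (k * q) * P
          regroup = solve-∀

  sum-cong : ∀ {n} {a b : Fin n → ℤ} → (∀ i → a i ~ b i) → ℤSum.sum a ~ ℤSum.sum b
  sum-cong {zero} eq = ~-refl
  sum-cong {suc n} eq = +-cong (eq F.zero) (sum-cong (λ i → eq (F.suc i)))

  Spans : ∀ {k r} → (Fin k → Fin r → ℤ) → (Fin r → ℤ) → Set
  Spans {k} v u = Σ (Fin k → ℤ) λ a → ∀ c → u c ~ ℤSum.sum (λ j → a j * v j c)

  unit : ∀ {r} → Fin r → Fin r → ℤ
  unit i c = δ c i

module CyclicEnum (k : ℕ) where
  m = suc k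

  residue : ℤ → ℕ
  residue x = x ℤ.%ℕ m

  residue< : ∀ x → residue x < m
  residue< x = n%ℕd<d x m

  division : ∀ x → x ≡ + residue x + (x ℤ./ℕ m) * + m
  division x = a≡a%ℕn+[a/ℕn]*n x m

  residue-cong : ∀ {x y} → Cyclic._≈_ m x y → residue x ≡ residue y
  residue-cong {x} {y} (j , x≡) =
    residue-unique m (residue x) (residue y) (residue< x) (residue< y) (qy + j - qx)
      (rearrange (residue x) (residue y) qy qx j (+ m) x≡ (division x) (division y))
    where
      qx = x ℤ./ℕ m
      qy = y ℤ./ℕ m
      rearrange : ∀ rx ry qy qx j M → ∀ {x y} → x ≡ y + j * M → x ≡ + rx + qx * M →
                  y ≡ + ry + qy * M → + rx ≡ + ry + (qy + j - qx) * M
      rearrange rx ry qy qx j M refl x≡ refl =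
        P.trans (flip-multiple _ _ qx M x≡) (regroup (+ ry) qy j qx M)
        where regroup : ∀ a qy j qx M → (a + qy * M) + j * M + (- qx) * M ≡ a + (qy + j - qx) * M
              regroup = solve-∀

  enum : Enum (Cyclic.group m)
  enum = record
    { N = m
    ; e = λ i → + toℕ i
    ; idx = λ x → fromℕ< (residue< x)
    ; idx-ok = λ x → - (x ℤ./ℕ m) , P.trans (cong +_ (FP.toℕ-fromℕ< (residue< x)))
                                            (flip-multiple x _ (x ℤ./ℕ m) (+ m) (division x))
    ; idx-cong = λ {x} {y} x≈y → FP.fromℕ<-cong _ _ (residue-cong {x} {y} x≈y) (residue< x) (residue< y)
    ; idx-e = λ i → P.trans (FP.fromℕ<-cong (toℕ i ℕ.% m) (toℕ i) (m<n⇒m%n≡m (FP.toℕ<n i)) (residue< (+ toℕ i)) (FP.toℕ<n i))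
                            (FP.fromℕ<-toℕ i (FP.toℕ<n i))
    }

module Rank (q : ℕ) (p-prime : Prime (suc (suc q))) where
  p = suc (suc q)
  open Mod p
  open ~-Reasoning
  private
    module Fp = Enum (CyclicEnum.enum (suc q))

  1≁0 : ¬ (+ 1 ~ + 0)
  1≁0 (mod (k , eq)) with residue-unique p 1 0 (ℕ.s≤s (ℕ.s≤s ℕ.z≤n)) (ℕ.s≤s ℕ.z≤n) k eq
  ... | ()

  ~0? : ∀ a → Dec (a ~ + 0)
  ~0? a with Fp.dec a (+ 0)
  ... | yes a≈0 = yes (mod a≈0)
  ... | no a≉0 = no (λ a~0 → a≉0 (witness a~0))

  inverse : ∀ c → ¬ (c ~ + 0) → Σ ℤ λ c' → c * c' ~ + 1
  inverse c c≁0 = from-bézout (coprime-Bézout (prime⇒coprime p-prime {{ℕ.≢-nonZero n≢0}} n<p))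
    where
      n = toℕ (Fp.idx c)
      c~n : c ~ + n
      c~n = ~-sym (mod (Fp.idx-ok c))
      n≢0 : ¬ n ≡ 0
      n≢0 n≡0 = c≁0 (~-trans c~n (≡⇒~ (cong +_ n≡0)))
      n<p : n < p
      n<p = FP.toℕ<n (Fp.idx c)
      lift : ∀ a b c d → 1 ℕ.+ a ℕ.* b ≡ c ℕ.* d → + 1 + + a * + b ≡ + c * + d
      lift a b c d eq = P.trans (cong (λ t → + 1 + t) (P.sym (ℤP.pos-* a b)))
        (P.trans (P.sym (ℤP.pos-+ 1 (a ℕ.* b))) (P.trans (cong +_ eq) (ℤP.pos-* c d)))
      from-bézout : Bézout.Identity 1 p n → Σ ℤ λ c' → c * c' ~ + 1
      from-bézout (Bézout.+- x y eq) = - + y , (begin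
        c * - + y                 ≈⟨ *-congʳ (- + y) c~n ⟩
        + n * - + y               ≡⟨ negate (+ n) (+ y) ⟩
        + 1 + - (+ 1 + + y * + n) ≡⟨ cong (λ t → + 1 + - t) (lift y n x p eq) ⟩
        + 1 + - (+ x * + p)       ≈⟨ mod (- + x , regroup (+ x) (+ p)) ⟩
        + 1                       ∎)
        where
          negate : ∀ n y → n * - y ≡ + 1 + - (+ 1 + y * n)
          negate = solve-∀
          regroup : ∀ x p → + 1 + - (x * p) ≡ + 1 + (- x) * p
          regroup = solve-∀
      from-bézout (Bézout.-+ x y eq) = + y , (begin
        c * + y     ≈⟨ *-congʳ (+ y) c~n ⟩
        + n * + y   ≈⟨ mod (+ x , P.trans (ℤP.*-comm (+ n) (+ y)) (P.sym (lift x p y n eq))) ⟩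
        + 1         ∎)

  zero-column : ∀ {k r} (v : Fin k → Fin r → ℤ) c → (∀ j → v j c ~ + 0) →
                ∀ {u} → Spans v u → u c ~ + 0
  zero-column v c vanishes (a , spans) = begin
    _                                   ≈⟨ spans c ⟩
    ℤSum.sum (λ j → a j * v j c)        ≈⟨ sum-cong (λ j → *-congˡ (a j) (vanishes j)) ⟩
    ℤSum.sum (λ j → a j * + 0)          ≡⟨ sum-zero _ (λ j → ℤP.*-zeroʳ (a j)) ⟩
    + 0                                 ∎

  -- One step of Gaussian elimination: with pivot row j (v j 0 invertible,
  -- inverse c'), clearing column 0 from the other rows and deleting row j
  -- and column 0 leaves rows w that span the rest of every vector spanned
  -- by v whose 0-th entry vanishes.
  module Eliminate {k r} (v : Fin (suc k) → Fin (suc r) → ℤ) (j : Fin (suc k))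
                   (c' : ℤ) (pivot : v j F.zero * c' ~ + 1) where
    pI = F.punchIn j

    w : Fin k → Fin r → ℤ
    w i c₁ = v (pI i) (F.suc c₁) - (v (pI i) F.zero * c') * v j (F.suc c₁)

    eliminate : ∀ u → u F.zero ≡ + 0 → Spans v u → Spans w (λ c₁ → u (F.suc c₁))
    eliminate u u₀≡0 (a , spans) = (λ i → a (pI i)) , λ c₁ → ~-sym (combination c₁)
      where
        c = v j F.zero
        R : Fin (suc r) → ℤ
        R col = ℤSum.sum (λ i → a (pI i) * v (pI i) col)
        split : ∀ col → ℤSum.sum (λ l → a l * v l col) ≡ a j * v j col + R col
        split col = ℤSum.sum-remove {i = j} (λ l → a l * v l col)
        R₀ : R F.zero ~ - (a j * c)
        R₀ = begin
          R F.zero                            ≡⟨ isolate (a j * c) (R F.zero) ⟩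
          - (a j * c) + (a j * c + R F.zero) ≈⟨ +-congˡ (- (a j * c)) (~-sym (P.subst (_~_ (+ 0)) (split F.zero)
                                                   (P.subst (_~ _) u₀≡0 (spans F.zero)))) ⟩
          - (a j * c) + + 0                   ≡⟨ ℤP.+-identityʳ _ ⟩
          - (a j * c)                         ∎
          where isolate : ∀ x y → y ≡ - x + (x + y)
                isolate = solve-∀
        combination : ∀ c₁ → ℤSum.sum (λ i → a (pI i) * w i c₁) ~ u (F.suc c₁)
        combination c₁ = begin
          ℤSum.sum (λ i → a (pI i) * w i c₁)   ≡⟨ linear ⟩
          R (F.suc c₁) + (- (c' * z)) * R F.zero ≈⟨ +-congˡ (R (F.suc c₁)) (*-congˡ (- (c' * z)) R₀) ⟩
          R (F.suc c₁) + (- (c' * z)) * (- (a j * c)) ≡⟨ cong (λ t → R (F.suc c₁) + t) (regroup c' z (a j) c) ⟩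
          R (F.suc c₁) + a j * z * (c * c')     ≈⟨ +-congˡ (R (F.suc c₁)) (*-congˡ (a j * z) pivot) ⟩
          R (F.suc c₁) + a j * z * + 1          ≡⟨ swap (R (F.suc c₁)) (a j * z) ⟩
          a j * z + R (F.suc c₁)                ≡⟨ P.sym (split (F.suc c₁)) ⟩
          ℤSum.sum (λ l → a l * v l (F.suc c₁)) ≈⟨ ~-sym (spans (F.suc c₁)) ⟩
          u (F.suc c₁)                          ∎
          where
            z = v j (F.suc c₁)
            regroup : ∀ c' z a c → (- (c' * z)) * (- (a * c)) ≡ a * z * (c * c')
            regroup = solve-∀
            swap : ∀ r t → r + t * + 1 ≡ t + r
            swap = solve-∀
            expand : ∀ b x y c' z → b * (x - (y * c') * z) ≡ b * x + (- (c' * z)) * (b * y)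
            expand = solve-∀
            linear : ℤSum.sum (λ i → a (pI i) * w i c₁) ≡ R (F.suc c₁) + (- (c' * z)) * R F.zero
            linear = P.trans (ℤSum.sum-cong-≗ (λ i → expand (a (pI i)) _ (v (pI i) F.zero) c' z))
                     (P.trans (ℤSum.∑-distrib-+ (λ i → a (pI i) * v (pI i) (F.suc c₁))
                                                (λ i → - (c' * z) * (a (pI i) * v (pI i) F.zero)))
                       (cong (λ t → R (F.suc c₁) + t) (P.sym (ℤSum.*-distribˡ-sum (- (c' * z)) (λ i → a (pI i) * v (pI i) F.zero)))))

  rank : ∀ k r (v : Fin k → Fin r → ℤ) → (∀ i → Spans v (unit i)) → r ≤ k
  rank k zero v spans = ℕ.z≤n
  rank zero (suc r) v spans = ⊥-elim (1≁0 (proj₂ (spans F.zero) F.zero))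
  rank (suc k) (suc r) v spans with FP.any? (λ j → ¬? (~0? (v j F.zero)))
  ... | no no-pivot = ⊥-elim (1≁0 (zero-column v F.zero vanishes (spans F.zero)))
    where
      vanishes : ∀ j → v j F.zero ~ + 0
      vanishes j with ~0? (v j F.zero)
      ... | yes v~0 = v~0
      ... | no v≁0 = ⊥-elim (no-pivot (j , v≁0))
  ... | yes (j , pivot≁0) with inverse (v j F.zero) pivot≁0
  ...   | c' , pivot = ℕ.s≤s (rank k r E.w (λ i → E.eliminate (unit (F.suc i)) refl (spans (F.suc i))))
    where module E = Eliminate v j c' pivot

-- a homomorphism G → (ℤ/M)^r, given by integer coordinates ψ x c
record ModHom (G : Grp) (M r : ℕ) : Set where
  open Group G using (Carrier; _≈_; _∙_)
  open Mod M using (_~_)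
  field
    ψ      : Carrier → Fin r → ℤ
    ψ-cong : ∀ {x y} → x ≈ y → ∀ c → ψ x c ~ ψ y c
    ψ-hom  : ∀ x y c → ψ (x ∙ y) c ~ ψ x c + ψ y c

module ModHomProperties {G : Grp} {M r : ℕ} (H : ModHom G M r) where
  open Group G hiding (refl)
  open ModHom H
  open Mod M
  open ~-Reasoning

  ψ-ε : ∀ c → ψ ε c ~ + 0
  ψ-ε c = begin
    ψ ε c                        ≡⟨ isolate (ψ ε c) ⟩
    - ψ ε c + (ψ ε c + ψ ε c)    ≈⟨ +-congˡ (- ψ ε c) (~-sym (~-trans (ψ-cong (sym (identityˡ ε)) c) (ψ-hom ε ε c))) ⟩
    - ψ ε c + ψ ε c              ≡⟨ ℤP.+-inverseˡ (ψ ε c) ⟩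
    + 0                          ∎
    where isolate : ∀ a → a ≡ - a + (a + a)
          isolate = solve-∀

  ψ-⁻¹ : ∀ x c → ψ (x ⁻¹) c ~ - ψ x c
  ψ-⁻¹ x c = begin
    ψ (x ⁻¹) c                          ≡⟨ isolate (ψ (x ⁻¹) c) (ψ x c) ⟩
    (ψ (x ⁻¹) c + ψ x c) + - ψ x c      ≈⟨ +-congʳ (- ψ x c) (~-sym (ψ-hom (x ⁻¹) x c)) ⟩
    ψ (x ⁻¹ ∙ x) c + - ψ x c            ≈⟨ +-congʳ (- ψ x c) (~-trans (ψ-cong (inverseˡ x) c) (ψ-ε c)) ⟩
    + 0 + - ψ x c                       ≡⟨ ℤP.+-identityˡ (- ψ x c) ⟩
    - ψ x c                             ∎
    where isolate : ∀ a b → a ≡ (a + b) + - b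
          isolate = solve-∀

  ψ-conj : ∀ g s c → ψ ((g ⁻¹ ∙ s) ∙ g) c ~ ψ s c
  ψ-conj g s c = begin
    ψ ((g ⁻¹ ∙ s) ∙ g) c               ≈⟨ ψ-hom (g ⁻¹ ∙ s) g c ⟩
    ψ (g ⁻¹ ∙ s) c + ψ g c             ≈⟨ +-congʳ (ψ g c) (ψ-hom (g ⁻¹) s c) ⟩
    (ψ (g ⁻¹) c + ψ s c) + ψ g c       ≈⟨ +-congʳ (ψ g c) (+-congʳ (ψ s c) (ψ-⁻¹ g c)) ⟩
    (- ψ g c + ψ s c) + ψ g c          ≡⟨ cancel (ψ g c) (ψ s c) ⟩
    ψ s c                              ∎
    where cancel : ∀ a b → (- a + b) + a ≡ b
          cancel = solve-∀

  closure-spans : ∀ {d} {S : Fin d → Carrier} {x} → InNormalClosure G S x →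
                  Spans (λ j → ψ (S j)) (ψ x)
  closure-spans {S = S} (conj i g) = (λ j → δ i j) , λ c → begin
    ψ ((g ⁻¹ ∙ S i) ∙ g) c                ≈⟨ ψ-conj g (S i) c ⟩
    ψ (S i) c                             ≡⟨ P.sym (sum-δ (λ j → ψ (S j) c) i) ⟩
    ℤSum.sum (λ j → ψ (S j) c * δ i j)    ≡⟨ ℤSum.sum-cong-≗ (λ j → ℤP.*-comm (ψ (S j) c) (δ i j)) ⟩
    ℤSum.sum (λ j → δ i j * ψ (S j) c)    ∎
  closure-spans {S = S} one = (λ _ → + 0) , λ c →
    ~-trans (ψ-ε c) (≡⇒~ (P.sym (sum-zero (λ j → + 0 * ψ (S j) c) (λ j → refl))))
  closure-spans {S = S} (mul {x} {y} px py) with closure-spans px | closure-spans py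
  ... | a , ha | b , hb = (λ j → a j + b j) , λ c → begin
    ψ (x ∙ y) c                                        ≈⟨ ψ-hom x y c ⟩
    ψ x c + ψ y c                                      ≈⟨ +-cong (ha c) (hb c) ⟩
    ℤSum.sum (λ j → a j * ψ (S j) c) + ℤSum.sum (λ j → b j * ψ (S j) c)
        ≡⟨ P.sym (ℤSum.∑-distrib-+ (λ j → a j * ψ (S j) c) (λ j → b j * ψ (S j) c)) ⟩
    ℤSum.sum (λ j → a j * ψ (S j) c + b j * ψ (S j) c)
        ≡⟨ ℤSum.sum-cong-≗ (λ j → P.sym (ℤP.*-distribʳ-+ (ψ (S j) c) (a j) (b j))) ⟩
    ℤSum.sum (λ j → (a j + b j) * ψ (S j) c)           ∎
  closure-spans {S = S} (inv {x} px) with closure-spans px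
  ... | a , ha = (λ j → - a j) , λ c → begin
    ψ (x ⁻¹) c                                ≈⟨ ψ-⁻¹ x c ⟩
    - ψ x c                                   ≈⟨ neg-cong (ha c) ⟩
    - ℤSum.sum (λ j → a j * ψ (S j) c)        ≡⟨ P.sym (sum-neg (λ j → a j * ψ (S j) c)) ⟩
    ℤSum.sum (λ j → - (a j * ψ (S j) c))      ≡⟨ ℤSum.sum-cong-≗ (λ j → ℤP.neg-distribˡ-* (a j) (ψ (S j) c)) ⟩
    ℤSum.sum (λ j → - a j * ψ (S j) c)        ∎
  closure-spans (resp x≈y px) with closure-spans px
  ... | a , ha = a , λ c → ~-trans (~-sym (ψ-cong x≈y c)) (ha c)

rank-bound : ∀ q (p-prime : Prime (suc (suc q))) {G : Grp} {r d} (H : ModHom G (suc (suc q)) r) →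
             (S : Fin d → Group.Carrier G) → (∀ x → InNormalClosure G S x) →
             (gs : Fin r → Group.Carrier G) → (∀ i c → Mod._~_ (suc (suc q)) (ModHom.ψ H (gs i) c) (Mod.unit (suc (suc q)) i c)) →
             r ≤ d
rank-bound q p-prime {r = r} {d} H S gen gs gs-unit = Rank.rank q p-prime d r (λ j → ψ (S j)) spans-unit
  where
    open ModHom H
    open Mod (suc (suc q))
    spans-unit : ∀ i → Spans (λ j → ψ (S j)) (unit i)
    spans-unit i with ModHomProperties.closure-spans H (gen (gs i))
    ... | a , ha = a , λ c → ~-trans (~-sym (gs-unit i c)) (ha c)

funToFin-cong : ∀ {n m} {f g : Fin n → Fin m} → (∀ i → f i ≡ g i) → F.funToFin f ≡ F.funToFin g
funToFin-cong {zero} f≗g = refl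
funToFin-cong {suc n} f≗g = P.cong₂ F.combine (f≗g F.zero) (funToFin-cong (λ i → f≗g (F.suc i)))

module Layer (k : ℕ) (W' : Grp) (EW : Enum W') where
  m = suc k
  C = Cyclic.group m
  W = C ≀ W'
  module C = Group C
  module W' = Group W'
  module W = Group W
  module EW = Enum EW
  module EC = Enum (CyclicEnum.enum k)
  module WW = Wreath C W'
  open WW using (Fun; mkFun; module Fun)
  open Fun using (app)
  module W'P = GroupProperties W'

  ≡⇒≈ : ∀ {x y} → x ≡ y → x C.≈ y
  ≡⇒≈ refl = C.refl

  zeroF : Fun
  zeroF = mkFun (λ _ → + 0) (λ _ → C.refl)

  _⊕_ : Fun → Fun → Fun
  f ⊕ g = mkFun (λ x → app f x + app g x)
                (λ {x} {y} x≈y → C.∙-cong {app f x} {app f y} {app g x} {app g y} (Fun.cong f x≈y) (Fun.cong g x≈y))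

  ⊖_ : Fun → Fun
  ⊖ f = mkFun (λ x → - app f x) (λ {x} {y} x≈y → C.⁻¹-cong {app f x} {app f y} (Fun.cong f x≈y))

  scale-cong : ∀ c {a b} → a C.≈ b → (c * a) C.≈ (c * b)
  scale-cong c a≈b = witness (*-congˡ c (mod a≈b))
    where open Mod m

  _⊙_ : ℤ → Fun → Fun
  c ⊙ f = mkFun (λ x → c * app f x) (λ x≈y → scale-cong c (Fun.cong f x≈y))

  sumF : ∀ {n} → (Fin n → Fun) → Fun
  sumF {zero} h = zeroF
  sumF {suc n} h = h F.zero ⊕ sumF (λ i → h (F.suc i))

  sumF-app : ∀ {n} (h : Fin n → Fun) x → app (sumF h) x ≡ ℤSum.sum (λ i → app (h i) x)
  sumF-app {zero} h x = refl
  sumF-app {suc n} h x = cong (λ t → app (h F.zero) x + t) (sumF-app (λ i → h (F.suc i)) x)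

  point : Fin EW.N → Fun
  point i = mkFun (λ t → δ (EW.idx t) i) (λ x≈y → ≡⇒≈ (cong (λ j → δ j i) (EW.idx-cong x≈y)))

  point-expansion : ∀ f x → app (sumF (λ i → app f (EW.e i) ⊙ point i)) x C.≈ app f x
  point-expansion f x =
    C.trans {app (sumF h) x} {app f (EW.e (EW.idx x))} {app f x}
      (≡⇒≈ (P.trans (sumF-app h x) (sum-δ (λ i → app f (EW.e i)) (EW.idx x))))
      (Fun.cong f (EW.idx-ok x))
    where h = λ i → app f (EW.e i) ⊙ point i

  top : W'.Carrier → W.Carrier
  top w = zeroF , w

  top-cong : ∀ {a b} → a W'.≈ b → top a W.≈ top b
  top-cong a≈b = (λ _ → C.refl) , a≈b

  top-∙ : ∀ a b → (top a W.∙ top b) W.≈ top (a W'.∙ b)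
  top-∙ a b = (λ _ → C.refl) , W'.refl

  x₀ : W.Carrier
  x₀ = point (EW.idx W'.ε) , W'.ε

  generators : ∀ {n} → (Fin n → W'.Carrier) → Fin (suc n) → W.Carrier
  generators S' F.zero = x₀
  generators S' (F.suc i) = top (S' i)

  x₀∉top : 1 ≤ k → ∀ w → ¬ (x₀ W.≈ top w)
  x₀∉top 1≤k w (base≈ , _) with base≈ W'.ε
  ... | j , eq with residue-unique m 1 0 (ℕ.s≤s 1≤k) (ℕ.s≤s ℕ.z≤n) j (P.trans (P.sym (δ-diag (EW.idx W'.ε))) eq)
  ... | ()

  -- W is enumerated by pairs (code of the base function, index in W'),
  -- coding base functions by their residues at e₁,…,e_N
  enum : Enum W
  enum = record
    { N = m ℕ.^ EW.N ℕ.* EW.N ; e = e ; idx = idx ; idx-ok = idx-ok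
    ; idx-cong = λ {x} {y} → idx-cong {x} {y} ; idx-e = idx-e }
    where
      code : Fun → Fin (m ℕ.^ EW.N)
      code f = F.funToFin (λ i → EC.idx (app f (EW.e i)))
      decode : Fin (m ℕ.^ EW.N) → Fun
      decode c = mkFun (λ t → + toℕ (F.finToFun c (EW.idx t)))
                       (λ x≈y → ≡⇒≈ (cong (λ j → + toℕ (F.finToFun c j)) (EW.idx-cong x≈y)))
      e : Fin (m ℕ.^ EW.N ℕ.* EW.N) → W.Carrier
      e c = decode (F.quotient EW.N c) , EW.e (F.remainder {m ℕ.^ EW.N} EW.N c)
      idx : W.Carrier → Fin (m ℕ.^ EW.N ℕ.* EW.N)
      idx (f , w) = F.combine (code f) (EW.idx w)
      decode-code : ∀ f t → app (decode (code f)) t C.≈ app f t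
      decode-code f t =
        C.trans {app (decode (code f)) t} {app f (EW.e (EW.idx t))} {app f t}
          (C.trans {app (decode (code f)) t} {+ toℕ (EC.idx (app f (EW.e (EW.idx t))))} {app f (EW.e (EW.idx t))}
            (≡⇒≈ (cong (λ j → + toℕ j) (FP.finToFun-funToFin (λ i → EC.idx (app f (EW.e i))) (EW.idx t))))
            (EC.idx-ok (app f (EW.e (EW.idx t)))))
          (Fun.cong f (EW.idx-ok t))
      idx-ok : ∀ x → e (idx x) W.≈ x
      idx-ok (f , w) with FP.remQuot-combine {m ℕ.^ EW.N} (code f) (EW.idx w)
      ... | eq = (λ t → P.subst (λ c → app (decode c) t C.≈ app f t) (P.sym (cong proj₁ eq)) (decode-code f t))
               , P.subst (λ i → EW.e i W'.≈ w) (P.sym (cong proj₂ eq)) (EW.idx-ok w)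
      idx-cong : ∀ {x y} → x W.≈ y → idx x ≡ idx y
      idx-cong {f , w} {f' , w'} (f≈f' , w≈w') = P.cong₂ F.combine
        (funToFin-cong (λ i → EC.idx-cong {app f (EW.e i)} {app f' (EW.e i)} (f≈f' (EW.e i))))
        (EW.idx-cong w≈w')
      idx-e : ∀ c → idx (e c) ≡ c
      idx-e c = P.trans (P.cong₂ F.combine
          (P.trans (funToFin-cong (λ i → P.trans (EC.idx-e _) (cong (F.finToFun (F.quotient EW.N c)) (EW.idx-e i))))
                   (FP.funToFin-finToFin {EW.N} {m} (F.quotient EW.N c)))
          (EW.idx-e _))
        (FP.combine-remQuot {m ℕ.^ EW.N} EW.N c)

  -- The standard generators normally generate W, provided S' normally
  -- generates W': the top group is reached through S', and every base
  -- element is a combination of conjugates x₀^{(e_i)} = (point i , ε).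
  module Generation {n} (S' : Fin n → W'.Carrier) where
    S = generators S'

    lift : ∀ {w} → InNormalClosure W' S' w → InNormalClosure W S (top w)
    lift (conj i g) = resp ((λ _ → C.refl) , W'.refl) (conj (F.suc i) (top g))
    lift one = resp ((λ _ → C.refl) , W'.refl) one
    lift (mul a b) = resp ((λ _ → C.refl) , W'.refl) (mul (lift a) (lift b))
    lift (inv a) = resp ((λ _ → C.refl) , W'.refl) (inv (lift a))
    lift (resp w≈w' a) = resp ((λ _ → C.refl) , w≈w') (lift a)

    InBase : Fun → Set
    InBase f = InNormalClosure W S (f , W'.ε)

    inBase-resp : ∀ {f g} → (∀ x → app f x C.≈ app g x) → InBase f → InBase g
    inBase-resp f≈g p = resp (f≈g , W'.refl) p

    inBase-zero : InBase zeroF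
    inBase-zero = resp ((λ _ → C.refl) , W'.refl) one

    inBase-⊕ : ∀ {f g} → InBase f → InBase g → InBase (f ⊕ g)
    inBase-⊕ {f} {g} p q = resp ((λ x → C.∙-congˡ {app f x} {app g (x W'.∙ W'.ε)} {app g x}
                                        (Fun.cong g (W'.identityʳ x)))
                                 , W'.identityʳ W'.ε) (mul p q)

    inBase-⊖ : ∀ {f} → InBase f → InBase (⊖ f)
    inBase-⊖ {f} p = resp ((λ x → C.⁻¹-cong {app f (x W'.∙ W'.ε W'.⁻¹)} {app f x}
                                    (Fun.cong f (W'.trans (W'.∙-congˡ W'P.ε⁻¹≈ε) (W'.identityʳ x))))
                           , W'P.ε⁻¹≈ε) (inv p)

    inBase-⊙ℕ : ∀ {f} → InBase f → ∀ n → InBase ((+ n) ⊙ f)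
    inBase-⊙ℕ p zero = inBase-resp (λ x → C.refl) inBase-zero
    inBase-⊙ℕ {f} p (suc n) = inBase-resp (λ x → ≡⇒≈ (P.sym (unfold n (app f x)))) (inBase-⊕ p (inBase-⊙ℕ p n))
      where
        unfold : ∀ n a → + suc n * a ≡ a + + n * a
        unfold n a = P.trans (cong (_* a) (P.sym (ℤP.pos-+ 1 n))) (distrib (+ n) a)
          where distrib : ∀ n a → (+ 1 + n) * a ≡ a + n * a
                distrib = solve-∀

    inBase-⊙ : ∀ {f} → InBase f → ∀ c → InBase (c ⊙ f)
    inBase-⊙ p (+ n) = inBase-⊙ℕ p n
    inBase-⊙ {f} p -[1+ n ] =
      inBase-resp (λ x → ≡⇒≈ (ℤP.neg-distribˡ-* (+ suc n) (app f x))) (inBase-⊖ (inBase-⊙ℕ p (suc n)))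

    inBase-sum : ∀ {j} (h : Fin j → Fun) → (∀ i → InBase (h i)) → InBase (sumF h)
    inBase-sum {zero} h ps = inBase-zero
    inBase-sum {suc j} h ps = inBase-⊕ (ps F.zero) (inBase-sum (λ i → h (F.suc i)) (λ i → ps (F.suc i)))

    -- point i is the conjugate of x₀ by e_i
    inBase-point : ∀ i → InBase (point i)
    inBase-point i = resp ((λ x → ≡⇒≈ (P.trans (ℤP.+-identityʳ _) (P.trans (ℤP.+-identityˡ _)
                             (δ-cong _ _ _ _ (translate x) (untranslate x)))))
                          , W'.trans (W'.∙-congʳ (W'.identityʳ _)) (W'.inverseˡ _))
                         (conj F.zero (top g))
      where
        g = EW.e i
        translate : ∀ x → EW.idx (x W'.∙ g W'.⁻¹) ≡ EW.idx W'.ε → EW.idx x ≡ i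
        translate x eq = P.trans (EW.idx-cong (W'P.x∙y⁻¹≈ε⇒x≈y x g (EW.idx-injective eq))) (EW.idx-e i)
        untranslate : ∀ x → EW.idx x ≡ i → EW.idx (x W'.∙ g W'.⁻¹) ≡ EW.idx W'.ε
        untranslate x eq = EW.idx-cong (W'P.x≈y⇒x∙y⁻¹≈ε (EW.idx-injective (P.trans eq (P.sym (EW.idx-e i)))))

    inBase-all : ∀ f → InBase f
    inBase-all f = inBase-resp (point-expansion f)
                     (inBase-sum _ (λ i → inBase-⊙ (inBase-point i) (app f (EW.e i))))

    generates : (∀ w → InNormalClosure W' S' w) → ∀ x → InNormalClosure W S x
    generates gen (f , w) =
      resp ((λ x → ≡⇒≈ (ℤP.+-identityʳ (app f x))) , W'.identityˡ w) (mul (inBase-all f) (lift (gen w)))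

  module WPow = Powers W
  module W'Pow = Powers W'

  pow-base : ∀ n f → WPow.pow n (f , W'.ε) W.≈ ((+ n) ⊙ f , W'.ε)
  pow-base zero f = (λ x → C.refl) , W'.refl
  pow-base (suc n) f = W.trans {WPow.pow (suc n) (f , W'.ε)} {(f , W'.ε) W.∙ ((+ n) ⊙ f , W'.ε)}
                                {(+ suc n) ⊙ f , W'.ε}
    (W.∙-congˡ {f , W'.ε} {WPow.pow n (f , W'.ε)} {(+ n) ⊙ f , W'.ε} (pow-base n f))
    ((λ x → C.trans {app f x + + n * app f (x W'.∙ W'.ε)} {app f x + + n * app f x} {+ suc n * app f x}
              (C.∙-congˡ {app f x} {+ n * app f (x W'.∙ W'.ε)} {+ n * app f x}
                (scale-cong (+ n) (Fun.cong f (W'.identityʳ x))))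
              (≡⇒≈ (fold n (app f x))))
     , W'.identityʳ W'.ε)
    where
      fold : ∀ n a → a + + n * a ≡ + suc n * a
      fold n a = P.trans (distrib (+ n) a) (cong (_* a) (ℤP.pos-+ 1 n))
        where distrib : ∀ n a → a + n * a ≡ (+ 1 + n) * a
              distrib = solve-∀

  base-order : ∀ f → WPow.pow m (f , W'.ε) W.≈ W.ε
  base-order f = W.trans {WPow.pow m (f , W'.ε)} {(+ m) ⊙ f , W'.ε} {W.ε} (pow-base m f)
    ((λ x → app f x , P.trans (ℤP.*-comm (+ m) (app f x)) (P.sym (ℤP.+-identityˡ (app f x * + m)))) , W'.refl)

  pow-top : ∀ n w → WPow.pow n (top w) W.≈ top (W'Pow.pow n w)
  pow-top zero w = (λ _ → C.refl) , W'.refl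
  pow-top (suc n) w = W.trans {top w W.∙ WPow.pow n (top w)} {top w W.∙ top (W'Pow.pow n w)}
                              {top (w W'.∙ W'Pow.pow n w)}
    (W.∙-congˡ {top w} {WPow.pow n (top w)} {top (W'Pow.pow n w)} (pow-top n w)) (top-∙ w (W'Pow.pow n w))

  translate : W'.Carrier → Fin EW.N → Fin EW.N
  translate w i = EW.idx (EW.e i W'.∙ w)

  translate-cancel : ∀ a b → (b W'.∙ a) W'.≈ W'.ε → ∀ i → translate a (translate b i) ≡ i
  translate-cancel a b ba≈ε i = P.trans (EW.idx-cong (begin
    EW.e (translate b i) ∙ a   ≈⟨ ∙-congʳ (EW.idx-ok _) ⟩
    (EW.e i ∙ b) ∙ a           ≈⟨ assoc _ _ _ ⟩
    EW.e i ∙ (b ∙ a)           ≈⟨ ∙-congˡ ba≈ε ⟩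
    EW.e i ∙ ε                 ≈⟨ identityʳ _ ⟩
    EW.e i                     ∎)) (EW.idx-e i)
    where
      open Group W' using (_∙_; ε; ∙-congˡ; ∙-congʳ; assoc; identityʳ)
      open SetoidReasoning W'.setoid

  base-sum : Fun → ℤ
  base-sum f = ℤSum.sum (λ i → app f (EW.e i))

  base-sum-translate : ∀ f w → Mod._~_ m (ℤSum.sum (λ i → app f (EW.e i W'.∙ w))) (base-sum f)
  base-sum-translate f w = begin
    ℤSum.sum (λ i → app f (EW.e i W'.∙ w))        ≈⟨ sum-cong (λ i → mod (Fun.cong f (W'.sym (EW.idx-ok (EW.e i W'.∙ w))))) ⟩
    ℤSum.sum (λ i → app f (EW.e (translate w i))) ≡⟨ P.sym (ℤSum.sum-permute (λ i → app f (EW.e i)) π) ⟩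
    base-sum f                                    ∎
    where
      open Mod m
      open ~-Reasoning
      π = permutation (translate w) (translate (w W'.⁻¹))
            (translate-cancel w (w W'.⁻¹) (W'.inverseˡ w)) (translate-cancel (w W'.⁻¹) w (W'.inverseʳ w))

  base-sum-hom : ∀ f₁ w₁ f₂ w₂ → Mod._~_ m (base-sum (proj₁ ((f₁ , w₁) W.∙ (f₂ , w₂)))) (base-sum f₁ + base-sum f₂)
  base-sum-hom f₁ w₁ f₂ w₂ = begin
    ℤSum.sum (λ i → app f₁ (EW.e i) + app f₂ (EW.e i W'.∙ w₁))
      ≡⟨ ℤSum.∑-distrib-+ (λ i → app f₁ (EW.e i)) (λ i → app f₂ (EW.e i W'.∙ w₁)) ⟩
    base-sum f₁ + ℤSum.sum (λ i → app f₂ (EW.e i W'.∙ w₁))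
      ≈⟨ +-congˡ (base-sum f₁) (base-sum-translate f₂ w₁) ⟩
    base-sum f₁ + base-sum f₂ ∎
    where
      open Mod m
      open ~-Reasoning

  -- If p ∣ m, a homomorphism ψ' : W' → (ℤ/p)^r extends to W → (ℤ/p)^{1+r},
  -- (f , w) ↦ (Σ f , ψ' w); it sends the generators to unit vectors when ψ'
  -- does so for those of W'.
  module Extend {p} (p∣m : p ∣ m) {r} (H : ModHom W' p r) where
    open Mod p
    private
      module H = ModHom H

    ψ : W.Carrier → Fin (suc r) → ℤ
    ψ (f , w) F.zero = base-sum f
    ψ (f , w) (F.suc c) = H.ψ w c

    extension : ModHom W p (suc r)
    extension = record { ψ = ψ ; ψ-cong = ψ-cong ; ψ-hom = ψ-hom }
      where
        ψ-cong : ∀ {x y} → x W.≈ y → ∀ c → ψ x c ~ ψ y c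
        ψ-cong {f , _} {f' , _} (f≈f' , _) F.zero =
          mod (Mod.reduce m p∣m (Mod.sum-cong m (λ i → Mod.mod (f≈f' (EW.e i)))))
        ψ-cong (_ , w≈w') (F.suc c) = H.ψ-cong w≈w' c
        ψ-hom : ∀ x y c → ψ (x W.∙ y) c ~ ψ x c + ψ y c
        ψ-hom (f₁ , w₁) (f₂ , w₂) F.zero = mod (Mod.reduce m p∣m (base-sum-hom f₁ w₁ f₂ w₂))
        ψ-hom (f₁ , w₁) (f₂ , w₂) (F.suc c) = H.ψ-hom w₁ w₂ c

    generators-unit : (S' : Fin r → W'.Carrier) → (∀ i c → H.ψ (S' i) c ~ unit i c) →
                      ∀ i c → ψ (generators S' i) c ~ unit i c
    generators-unit S' S'-unit F.zero F.zero = ≡⇒~ (P.trans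
      (ℤSum.sum-cong-≗ (λ i → P.trans (cong (λ j → δ j (EW.idx W'.ε)) (EW.idx-e i))
                               (P.trans (δ-sym i (EW.idx W'.ε)) (P.sym (ℤP.*-identityˡ _)))))
      (sum-δ (λ _ → + 1) (EW.idx W'.ε)))
    generators-unit S' S'-unit F.zero (F.suc c) = ModHomProperties.ψ-ε H c
    generators-unit S' S'-unit (F.suc i) F.zero = ≡⇒~ (sum-zero {EW.N} (λ _ → + 0) (λ _ → refl))
    generators-unit S' S'-unit (F.suc i) (F.suc c) = S'-unit i c

wreathEnum : ∀ m ms → 1 ≤ m → All (1 ≤_) ms → Enum (IterWreath m ms)
wreathEnum (suc k) [] _ _ = CyclicEnum.enum k
wreathEnum (suc k) (m' ∷ ms) _ (1≤m' ∷ 1≤ms) = Layer.enum k (IterWreath m' ms) (wreathEnum m' ms 1≤m' 1≤ms)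

-- the generator 1 of each cyclic factor, the inner ones moved into the top groups
standardGenerators : ∀ m ms → 1 ≤ m → All (1 ≤_) ms → Fin (suc (length ms)) → Group.Carrier (IterWreath m ms)
standardGenerators (suc k) [] _ _ _ = + 1
standardGenerators (suc k) (m' ∷ ms) _ (1≤m' ∷ 1≤ms) =
  Layer.generators k (IterWreath m' ms) (wreathEnum m' ms 1≤m' 1≤ms) (standardGenerators m' ms 1≤m' 1≤ms)

factorOrder : (m : ℕ) (ms : List ℕ) → Fin (suc (length ms)) → ℕ
factorOrder m ms F.zero = m
factorOrder m (m' ∷ ms) (F.suc i) = factorOrder m' ms i

cyclic-generated : ∀ m x → InNormalClosure (Cyclic.group m) (λ (_ : Fin 1) → + 1) x
cyclic-generated m (+ n) = multiples n
  where
    NC = InNormalClosure (Cyclic.group m) (λ (_ : Fin 1) → + 1)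
    generator : NC (+ 1)
    generator = resp (Group.refl (Cyclic.group m)) (conj F.zero (+ 0))
    multiples : ∀ n → NC (+ n)
    multiples zero = one
    multiples (suc n) = resp (Group.refl (Cyclic.group m)) (mul generator (multiples n))
cyclic-generated m -[1+ n ] = resp (Group.refl (Cyclic.group m)) (inv (cyclic-generated m (+ suc n)))

standardGenerators-generate : ∀ m ms h hs x → InNormalClosure (IterWreath m ms) (standardGenerators m ms h hs) x
standardGenerators-generate (suc k) [] _ _ x = cyclic-generated (suc k) x
standardGenerators-generate (suc k) (m' ∷ ms) _ (h ∷ hs) =
  Layer.Generation.generates k (IterWreath m' ms) (wreathEnum m' ms h hs) (standardGenerators m' ms h hs)
    (standardGenerators-generate m' ms h hs)

standardGenerators-order : ∀ m ms h hs i →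
  Group._≈_ (IterWreath m ms) (Powers.pow (IterWreath m ms) (factorOrder m ms i) (standardGenerators m ms h hs i))
                              (Group.ε (IterWreath m ms))
standardGenerators-order (suc k) [] _ _ F.zero = + 1 , P.trans (multiple (suc k)) (P.sym (P.trans (ℤP.+-identityˡ _) (ℤP.*-identityˡ (+ suc k))))
  where
    multiple : ∀ n → Powers.pow (Cyclic.group (suc k)) n (+ 1) ≡ + n
    multiple zero = refl
    multiple (suc n) = cong (λ t → + 1 + t) (multiple n)
standardGenerators-order (suc k) (m' ∷ ms) _ (h ∷ hs) F.zero = L.base-order _
  where module L = Layer k (IterWreath m' ms) (wreathEnum m' ms h hs)
standardGenerators-order (suc k) (m' ∷ ms) _ (h ∷ hs) (F.suc i) =
  L.W.trans {L.WPow.pow n (L.top g)} {L.top (Powers.pow W' n g)} {L.W.ε}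
    (L.pow-top n g) (L.top-cong (standardGenerators-order m' ms h hs i))
  where
    W' = IterWreath m' ms
    module L = Layer k W' (wreathEnum m' ms h hs)
    n = factorOrder m' ms i
    g = standardGenerators m' ms h hs i

standardGenerators-distinct : ∀ m ms h hs → 2 ≤ m → All (2 ≤_) ms → ∀ i j →
  Group._≈_ (IterWreath m ms) (standardGenerators m ms h hs i) (standardGenerators m ms h hs j) → i ≡ j
standardGenerators-distinct (suc k) [] _ _ _ _ F.zero F.zero _ = refl
standardGenerators-distinct (suc k) (m' ∷ ms) _ (h ∷ hs) _ _ F.zero F.zero _ = refl
standardGenerators-distinct (suc k) (m' ∷ ms) _ (h ∷ hs) (ℕ.s≤s 1≤k) _ F.zero (F.suc j) x₀≈ =
  ⊥-elim (Layer.x₀∉top k (IterWreath m' ms) (wreathEnum m' ms h hs) 1≤k _ x₀≈)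
standardGenerators-distinct (suc k) (m' ∷ ms) h₀ (h ∷ hs) (ℕ.s≤s 1≤k) _ (F.suc i) F.zero ≈x₀ =
  ⊥-elim (Layer.x₀∉top k (IterWreath m' ms) (wreathEnum m' ms h hs) 1≤k _
    (Group.sym (IterWreath (suc k) (m' ∷ ms)) {standardGenerators (suc k) (m' ∷ ms) h₀ (h ∷ hs) (F.suc i)}
                                              {standardGenerators (suc k) (m' ∷ ms) h₀ (h ∷ hs) F.zero} ≈x₀))
standardGenerators-distinct (suc k) (m' ∷ ms) _ (h ∷ hs) _ (2≤m' ∷ 2≤ms) (F.suc i) (F.suc j) (_ , eq) =
  cong F.suc (standardGenerators-distinct m' ms h hs 2≤m' 2≤ms i j eq)

wreath-unitHom : ∀ {p} m ms h hs → p ∣ m → All (p ∣_) ms →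
  Σ (ModHom (IterWreath m ms) p (suc (length ms))) λ H →
    ∀ i c → Mod._~_ p (ModHom.ψ H (standardGenerators m ms h hs i) c) (Mod.unit p i c)
wreath-unitHom {p} (suc k) [] _ _ p∣m _ =
  record { ψ = λ x _ → x ; ψ-cong = λ {x} {y} x≈y _ → Mod.mod (Mod.reduce (suc k) p∣m {x} {y} (Mod.mod x≈y))
         ; ψ-hom = λ x y _ → Mod.~-refl p }
  , λ { F.zero F.zero → Mod.~-refl p }
wreath-unitHom (suc k) (m' ∷ ms) _ (h ∷ hs) p∣m (p∣m' ∷ p∣ms) with wreath-unitHom m' ms h hs p∣m' p∣ms
... | H' , H'-unit = E.extension , E.generators-unit (standardGenerators m' ms h hs) H'-unit
  where module E = Layer.Extend k (IterWreath m' ms) (wreathEnum m' ms h hs) p∣m H'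

normalRank-unique : ∀ {G a b} → IsNormalRank G a → IsNormalRank G b → a ≡ b
normalRank-unique (ng-a , min-a) (ng-b , min-b) =
  ℕP.≤-antisym (ℕP.≮⇒≥ (λ b<a → min-a _ b<a ng-b)) (ℕP.≮⇒≥ (λ a<b → min-b _ a<b ng-a))

prime-form : ∀ {p} → Prime p → Σ ℕ λ q → p ≡ suc (suc q)
prime-form {zero} p-prime = ⊥-elim (¬prime[0] p-prime)
prime-form {suc zero} p-prime = ⊥-elim (¬prime[1] p-prime)
prime-form {suc (suc q)} p-prime = q , refl

prime∣⇒2≤ : ∀ {p m} → Prime p → 1 ≤ m → p ∣ m → 2 ≤ m
prime∣⇒2≤ {m = suc _} p-prime _ p∣m with prime-form p-prime
... | q , refl = ℕP.≤-trans (ℕ.s≤s (ℕ.s≤s ℕ.z≤n)) (∣⇒≤ p∣m)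

prime∣⇒2≤-all : ∀ {p ms} → Prime p → All (1 ≤_) ms → All (p ∣_) ms → All (2 ≤_) ms
prime∣⇒2≤-all p-prime [] [] = []
prime∣⇒2≤-all p-prime (h ∷ hs) (p∣m ∷ p∣ms) = prime∣⇒2≤ p-prime h p∣m ∷ prime∣⇒2≤-all p-prime hs p∣ms

-- d(W) = r when a prime divides the orders of all r cyclic factors of W:
-- the standard generators give d(W) ≤ r, the unit-vector map gives d(W) ≥ r
wreath-normalRank : ∀ {p} → Prime p → ∀ m ms (h : 1 ≤ m) (hs : All (1 ≤_) ms) → p ∣ m → All (p ∣_) ms →
                    IsNormalRank (IterWreath m ms) (suc (length ms))
wreath-normalRank p-prime m ms h hs p∣m p∣ms with prime-form p-prime
... | q , refl =
  (S , standardGenerators-distinct m ms h hs (prime∣⇒2≤ p-prime h p∣m) (prime∣⇒2≤-all p-prime hs p∣ms)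
     , standardGenerators-generate m ms h hs)
  , λ d d<r (S' , _ , S'-generates) →
      ℕP.<⇒≱ d<r (rank-bound q p-prime (proj₁ unitHom) S' S'-generates S (proj₂ unitHom))
  where
    S = standardGenerators m ms h hs
    unitHom = wreath-unitHom m ms h hs p∣m p∣ms

normalRank-cover : ∀ {G} → IsFinite G → ∀ {d} → IsNormalRank G d → ∀ m ms (h : 1 ≤ m) (hs : All (1 ≤_) ms) →
                   Epi (IterWreath m ms) G → d ≤ suc (length ms)
normalRank-cover fin rank m ms h hs E =
  normalRank-epi E fin rank (standardGenerators m ms h hs) (standardGenerators-generate m ms h hs)

inner-factors : ∀ {P : ℕ → Set} m ms → (∀ i → P (factorOrder m ms i)) → All P ms
inner-factors m [] all = []
inner-factors m (m' ∷ ms) all = all (F.suc F.zero) ∷ inner-factors m' ms (λ i → all (F.suc i))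

-- If d(G) = r and C_{m₁} ≀ ⋯ ≀ C_{m_r} maps onto G, a prime divides every mᵢ:
-- the gcd g of the mᵢ is not 1 by the collapse lemma, and not 0 as g ∣ m₁.
common-prime : ∀ {G} → IsFinite G → ∀ m ms (h : 1 ≤ m) (hs : All (1 ≤_) ms) → Epi (IterWreath m ms) G →
               IsNormalRank G (suc (length ms)) → Σ ℕ λ p → Prime p × p ∣ m × All (p ∣_) ms
common-prime {G} fin m ms h hs E@(f , f-hom , _) rank = p , p-prime , p∣order F.zero , inner-factors m ms p∣order
  where
    S = standardGenerators m ms h hs
    y-order : ∀ i → Group._≈_ G (Powers.pow G (factorOrder m ms i) (f (S i))) (Group.ε G)
    y-order i = Group.trans G (Group.sym G (Image.pow-homo {IterWreath m ms} {G} f f-hom (factorOrder m ms i) (S i)))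
      (Group.trans G (MS.IsGroupHomomorphism.⟦⟧-cong f-hom (standardGenerators-order m ms h hs i))
                     (MS.IsGroupHomomorphism.ε-homo f-hom))
    g = gcdAll (factorOrder m ms)
    g≢1 : ¬ g ≡ 1
    g≢1 = Collapse.gcd≢1 G (λ i → f (S i)) (factorOrder m ms) y-order fin rank
            (epi-generates E S (standardGenerators-generate m ms h hs))
    2≤g : 2 ≤ g
    2≤g with g | g≢1 | gcdAll-∣ (factorOrder m ms) F.zero
    ... | zero | _ | 0∣m = ⊥-elim (ℕP.<⇒≢ h (P.sym (0∣⇒≡0 0∣m)))
    ... | suc zero | g≢1 | _ = ⊥-elim (g≢1 refl)
    ... | suc (suc _) | _ | _ = ℕ.s≤s (ℕ.s≤s ℕ.z≤n)
    p = proj₁ (prime-factor g 2≤g)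
    p-prime = proj₁ (proj₂ (prime-factor g 2≤g))
    p∣order : ∀ i → p ∣ factorOrder m ms i
    p∣order i = ∣-trans (proj₂ (proj₂ (prime-factor g 2≤g))) (gcdAll-∣ (factorOrder m ms) i)

WreathLengthIsNormalRank : Grp → Set
WreathLengthIsNormalRank G = Σ ℕ λ n → IsWreathLength G n × IsNormalRank G n

PrimeWreathCover : Grp → Set
PrimeWreathCover G = Σ ℕ λ p → Prime p × (Σ ℕ λ m → Σ (List ℕ) λ ms →
  (1 ≤ m) × All (1 ≤_) ms × (p ∣ m) × All (p ∣_) ms
  × Epi (IterWreath m ms) G
  × (Σ ℕ λ d → IsNormalRank (IterWreath m ms) d × IsNormalRank G d))

-- (⇒) a shortest cover has r = d(G) factors, so they share a prime p, and then d(W) = r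
wreathLength⇒primeCover : ∀ {G} → IsFinite G → WreathLengthIsNormalRank G → PrimeWreathCover G
wreathLength⇒primeCover fin (_ , (_ , (m , ms , refl , h , hs , E) , _) , rank)
  with common-prime fin m ms h hs E rank
... | p , p-prime , p∣m , p∣ms =
  p , p-prime , m , ms , h , hs , p∣m , p∣ms , E , _ , wreath-normalRank p-prime m ms h hs p∣m p∣ms , rank

-- (⇐) d(G) = d(W) = r, so the given cover has d(G) factors and none is shorter
primeCover⇒wreathLength : ∀ {G} → IsFinite G → PrimeWreathCover G → WreathLengthIsNormalRank G
primeCover⇒wreathLength {G} fin (p , p-prime , m , ms , h , hs , p∣m , p∣ms , E , d , rankW , rankG) =
  r , (ℕ.s≤s ℕ.z≤n , (m , ms , refl , h , hs , E) , shortest) , P.subst (IsNormalRank G) d≡r rankG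
  where
    r = suc (length ms)
    d≡r : d ≡ r
    d≡r = normalRank-unique rankW (wreath-normalRank p-prime m ms h hs p∣m p∣ms)
    shortest : ∀ r' → 1 ≤ r' → r' < r → ¬ WreathCover G r'
    shortest r' _ r'<r (m' , ms' , refl , h' , hs' , E') =
      ℕP.<⇒≱ (P.subst (_ <_) (P.sym d≡r) r'<r) (normalRank-cover fin rankG m' ms' h' hs' E')

proposition3p6 : (G : Grp) → IsFinite G → SemiAbelian G →
    ((Σ ℕ λ n → IsWreathLength G n × IsNormalRank G n)
    ⇔
    (Σ ℕ λ p → Prime p × (Σ ℕ λ m → Σ (List ℕ) λ ms →
    (1 ≤ m) × All (1 ≤_) ms × (p ∣ m) × All (p ∣_) ms
    × Epi (IterWreath m ms) G
    × (Σ ℕ λ d → IsNormalRank (IterWreath m ms) d × IsNormalRank G d))))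
proposition3p6 G fin _ = mk⇔ (wreathLength⇒primeCover fin) (primeCover⇒wreathLength fin)
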